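{- For integers $n\ge 2$ and $k$, let $Q_n(k) := P\big(2n-1-|S-S| = k \,\big|\, 0\in S,\ n-1\in S\big)$, where $S$ is a uniformly random subset of $[n]$; and for positive integers $m$ let \[ g_k(m) := P_{S\subseteq[2m]}\big(|(S-S)\cap\{m,\dots,2m-1\}| = m-k \,\big|\, 0\in S,\ 2m-1\in S\big). \] Then for every integer $k\ge 0$ the limit $j(k) := \lim_{n\to\infty} Q_n(k)$ exists, and for all integers $k\ge 0$ and all integers $m>k$, \[ |j(2k) - g_k(m)| < \tfrac{16}{9}\left(\tfrac{3}{4}\right)^{m+1}. \]
   Context: For a positive integer $n$, $[n] := \{0,1,\dots,n-1\}$; random subsets are uniform over all $2^n$ subsets. $S-S := \{x-y : x,y\in S\}$. -}

module Defs where

open import Data.Bool using (Bool; true; false; _∧_; _∨_)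
open import Data.Nat as ℕ using (ℕ; zero; suc; _∸_)
open import Data.Integer as ℤ using (ℤ; +_)
open import Data.Rational as ℚ using (ℚ; 0ℚ; 1ℚ)
open import Data.List using (List; []; _∷_; map; length; filterᵇ; upTo; _++_)
open import Data.Bool.ListAction using (any)
open import Data.Vec using (Vec; []; _∷_)
open import Relation.Nullary using (does)

-- A subset of [n] = {0,…,n-1} as a characteristic vector (position i ↔ element i).
Subset : ℕ → Set
Subset n = Vec Bool n

allSubsets : (n : ℕ) → List (Subset n)
allSubsets zero    = [] ∷ []
allSubsets (suc n) = map (false ∷_) (allSubsets n) ++ map (true ∷_) (allSubsets n)

elem : {n : ℕ} → Subset n → ℕ → Bool
elem []      x       = false
elem (b ∷ S) zero    = b
elem (b ∷ S) (suc x) = elem S x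

inDiff : {n : ℕ} → Subset n → ℤ → Bool
inDiff {n} S d =
  any (λ x → any (λ y → elem S x ∧ elem S y ∧ does ((+ x) ℤ.- (+ y) ℤ.≟ d)) (upTo n)) (upTo n)

-- |S - S|: every difference lies in {-(n-1),…,n-1}, so count those integers that lie in S - S
diffSetSize : {n : ℕ} → Subset n → ℕ
diffSetSize {n} S =
  length (filterᵇ (inDiff S) (map (λ i → (+ i) ℤ.- (+ (n ∸ 1))) (upTo (2 ℕ.* n ∸ 1))))

diffUpperSize : {n : ℕ} → (m : ℕ) → Subset n → ℕ
diffUpperSize {n} m S = length (filterᵇ (λ i → inDiff S (+ (m ℕ.+ i))) (upTo m))

-- ratio a/b as a rational (b = 0 never occurs for the conditional probabilities used below)
ratio : ℕ → ℕ → ℚ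
ratio a zero    = 0ℚ
ratio a (suc b) = (+ a) ℚ./ suc b

count : {A : Set} → (A → Bool) → List A → ℕ
count p xs = length (filterᵇ p xs)

condProb : (n : ℕ) → (Subset n → Bool) → (Subset n → Bool) → ℚ
condProb n E C = ratio (count (λ S → E S ∧ C S) (allSubsets n)) (count C (allSubsets n))

Q : ℕ → ℕ → ℚ
Q n k = condProb n (λ S → does ((2 ℕ.* n ∸ 1) ∸ diffSetSize S ℕ.≟ k))
                   (λ S → elem S 0 ∧ elem S (n ∸ 1))

g : ℕ → ℕ → ℚ
g k m = condProb (2 ℕ.* m) (λ S → does (diffUpperSize m S ℕ.≟ (m ∸ k)))
                           (λ S → elem S 0 ∧ elem S (2 ℕ.* m ∸ 1))

_^ℚ_ : ℚ → ℕ → ℚ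
q ^ℚ zero  = 1ℚ
q ^ℚ suc e = q ℚ.* (q ^ℚ e)

bound : ℕ → ℚ
bound m = ((+ 16) ℚ./ 9) ℚ.* (((+ 3) ℚ./ 4) ^ℚ suc m)

-- Write N = H + r + H. As 0 ∈ S and S - S is symmetric, 2N - 1 - |S - S| is twice the
-- number of d ∈ [1, N - 1] missing from S - S. If every d ≤ N - 1 - H occurs, only the H
-- longest differences can be missing, and such a difference can only join the first H
-- positions of S to the last H. So, off this bad event, the deficiency of S is determined by
-- its outer blocks T ⊆ [2H] — it is 2(H - |(T - T) ∩ [H, 2H)|) — and conditioned on
-- 0, N - 1 ∈ S these blocks are a uniform T with 0, 2H - 1 ∈ T. Hence Q_N(K) is within
-- Pr(bad) of a number depending on H only. A fixed difference d is missing only if each of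
-- some disjoint pairs {x, x + d} ⊄ S, which are independent events of probability 3/4;
-- summing over d bounds Pr(bad) by (3/4)^(H - 1) = 16/9 · (3/4)^(H + 1) for N large, with a
-- fixed margin from the overlap of the two longest differences. Letting H grow gives the
-- Cauchy property, and H = m gives the comparison with g_k(m).

module Submission where

open import Defs
open import Data.Bool using (Bool; true; false; _∧_; _∨_; not; T)
open import Data.Bool.Properties
  using (∧-comm; ∧-zeroʳ; ∧-identityʳ; ∧-conicalˡ; ∧-conicalʳ; ∨-assoc; ∨-identityʳ; ∨-zeroʳ; T-∨)
open import Data.Bool.ListAction using (any)
open import Data.Empty using (⊥; ⊥-elim)
open import Data.Integer as ℤ using (ℤ; -[1+_])
import Data.Integer.Properties as ℤ
import Data.Integer.Tactic.RingSolver as ℤ-Solver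
open import Data.List using (List; []; _∷_; map; length; filterᵇ; _++_; upTo; applyUpTo)
open import Data.List.Properties using (filter-++; length-++; length-map)
open import Data.List.Membership.Propositional using (_∈_)
open import Data.List.Relation.Unary.All as All using (All; []; _∷_)
import Data.List.Relation.Unary.All.Properties as All
open import Data.List.Relation.Unary.AllPairs using (AllPairs; []; _∷_)
import Data.List.Relation.Unary.AllPairs.Properties as AllPairs
open import Data.List.Relation.Unary.Any as Any using (here; there)
open import Data.List.Relation.Unary.Any.Properties using (any⁻; any⁺)
open import Data.Nat hiding (∣_-_∣)
open import Data.Nat.Properties
open import Data.Nat.Tactic.RingSolver using (solve-∀)
open import Data.Product using (Σ; _×_; _,_; ∃; ∃-syntax)
open import Data.Rational as ℚ using (ℚ; mkℚ; 0ℚ; 1ℚ; _-_; -_; ∣_∣; toℚᵘ)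
  renaming (_+_ to _+ℚ_; _*_ to _*ℚ_; _≤_ to _≤ℚ_; _<_ to _<ℚ_)
import Data.Rational.Properties as ℚ
open import Data.Rational.Solver using (module +-*-Solver)
open import Data.Rational.Unnormalised as ℚᵘ using (mkℚᵘ; *≤*; *<*) renaming (_≃_ to _≃ᵘ_)
import Data.Rational.Unnormalised.Properties as ℚᵘ
open import Data.Sum using (inj₁; inj₂)
open import Data.Unit using (tt)
open import Data.Vec using (Vec; []; _∷_; take; drop) renaming (_++_ to _++ᵥ_)
open import Data.Vec.Properties using (take++drop≡id)
open import Function using (_∘_)
open import Function.Bundles using (Equivalence)
open import Relation.Binary.PropositionalEquality
open import Relation.Nullary using (Dec; does; yes; no)
open import Relation.Nullary.Decidable using (dec-true)

open +-*-Solver using (solve; _:+_; _:*_; _:-_; :-_; _:=_; con)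

private variable
  A B : Set

-- Counting subsets

toℕ : Bool → ℕ
toℕ false = 0
toℕ true  = 1

count-∷ : (p : A → Bool) (x : A) (xs : List A) → count p (x ∷ xs) ≡ toℕ (p x) + count p xs
count-∷ p x xs with p x
... | true  = refl
... | false = refl

count-++ : (p : A → Bool) (xs ys : List A) → count p (xs ++ ys) ≡ count p xs + count p ys
count-++ p xs ys = trans (cong length (filter-++ _ xs ys)) (length-++ (filterᵇ p xs))

count-map : (p : B → Bool) (f : A → B) (xs : List A) → count p (map f xs) ≡ count (p ∘ f) xs
count-map p f []       = refl
count-map p f (x ∷ xs) with p (f x)
... | true  = cong suc (count-map p f xs)
... | false = count-map p f xs

count-cong : {p q : A → Bool} → (∀ x → p x ≡ q x) → (xs : List A) → count p xs ≡ count q xs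
count-cong h []       = refl
count-cong {p = p} {q} h (x ∷ xs) rewrite count-∷ p x xs | count-∷ q x xs | h x =
  cong (toℕ (q x) +_) (count-cong h xs)

count-const : (b : Bool) (xs : List A) → count (λ _ → b) xs ≡ toℕ b * length xs
count-const b     []       = sym (*-zeroʳ (toℕ b))
count-const false (x ∷ xs) = count-const false xs
count-const true  (x ∷ xs) = cong suc (count-const true xs)

count-mono : {p q : A → Bool} → (∀ x → p x ≡ true → q x ≡ true) → (xs : List A) → count p xs ≤ count q xs
count-mono h []       = z≤n
count-mono {p = p} {q} h (x ∷ xs) rewrite count-∷ p x xs | count-∷ q x xs =
  +-mono-≤ (toℕ-mono (p x) (q x) (h x)) (count-mono h xs)
  where
  toℕ-mono : ∀ a b → (a ≡ true → b ≡ true) → toℕ a ≤ toℕ b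
  toℕ-mono false b     _ = z≤n
  toℕ-mono true  b     h rewrite h refl = ≤-refl

private
  +-interchange : ∀ a b c d → (a + b) + (c + d) ≡ (a + c) + (b + d)
  +-interchange = solve-∀

count-subadditive : {p q r : A → Bool} → (∀ x → toℕ (p x) ≤ toℕ (q x) + toℕ (r x)) →
                    (xs : List A) → count p xs ≤ count q xs + count r xs
count-subadditive h []       = z≤n
count-subadditive {p = p} {q} {r} h (x ∷ xs)
  rewrite count-∷ p x xs | count-∷ q x xs | count-∷ r x xs =
  ≤-trans (+-mono-≤ (h x) (count-subadditive h xs))
          (≤-reflexive (+-interchange (toℕ (q x)) (toℕ (r x)) (count q xs) (count r xs)))

count-additive : {p q r s : A → Bool} → (∀ x → toℕ (p x) + toℕ (q x) ≡ toℕ (r x) + toℕ (s x)) →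
                 (xs : List A) → count p xs + count q xs ≡ count r xs + count s xs
count-additive h []       = refl
count-additive {p = p} {q} {r} {s} h (x ∷ xs)
  rewrite count-∷ p x xs | count-∷ q x xs | count-∷ r x xs | count-∷ s x xs = begin
    (toℕ (p x) + count p xs) + (toℕ (q x) + count q xs) ≡⟨ +-interchange (toℕ (p x)) _ _ _ ⟩
    (toℕ (p x) + toℕ (q x)) + (count p xs + count q xs) ≡⟨ cong₂ _+_ (h x) (count-additive h xs) ⟩
    (toℕ (r x) + toℕ (s x)) + (count r xs + count s xs) ≡⟨ +-interchange (toℕ (r x)) _ _ _ ⟩
    (toℕ (r x) + count r xs) + (toℕ (s x) + count s xs) ∎
  where open ≡-Reasoning

countSubsets : (N : ℕ) → (Subset N → Bool) → ℕ
countSubsets N P = count P (allSubsets N)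

countSubsets-suc : (N : ℕ) (P : Subset (suc N) → Bool) →
                   countSubsets (suc N) P ≡ countSubsets N (P ∘ (false ∷_)) + countSubsets N (P ∘ (true ∷_))
countSubsets-suc N P = trans (count-++ P (map (false ∷_) (allSubsets N)) (map (true ∷_) (allSubsets N)))
  (cong₂ _+_ (count-map P (false ∷_) (allSubsets N)) (count-map P (true ∷_) (allSubsets N)))

length-allSubsets : (N : ℕ) → length (allSubsets N) ≡ 2 ^ N
length-allSubsets zero    = refl
length-allSubsets (suc N) = begin
  length (map (false ∷_) (allSubsets N) ++ map (true ∷_) (allSubsets N))
    ≡⟨ length-++ (map (false ∷_) (allSubsets N)) ⟩
  length (map (false ∷_) (allSubsets N)) + length (map (true ∷_) (allSubsets N))
    ≡⟨ cong₂ _+_ (length-map _ (allSubsets N)) (length-map _ (allSubsets N)) ⟩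
  length (allSubsets N) + length (allSubsets N)
    ≡⟨ cong (λ z → z + z) (length-allSubsets N) ⟩
  2 ^ N + 2 ^ N
    ≡⟨ cong (2 ^ N +_) (sym (+-identityʳ (2 ^ N))) ⟩
  2 ^ suc N ∎
  where
  open ≡-Reasoning

countSubsets-const : (N : ℕ) (b : Bool) → countSubsets N (λ _ → b) ≡ toℕ b * 2 ^ N
countSubsets-const N b = trans (count-const b (allSubsets N)) (cong (toℕ b *_) (length-allSubsets N))

countSubsets-cong : (N : ℕ) {P Q : Subset N → Bool} → (∀ S → P S ≡ Q S) → countSubsets N P ≡ countSubsets N Q
countSubsets-cong N h = count-cong h (allSubsets N)

countSubsets-mono : (N : ℕ) {P Q : Subset N → Bool} → (∀ S → P S ≡ true → Q S ≡ true) →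
                    countSubsets N P ≤ countSubsets N Q
countSubsets-mono N h = count-mono h (allSubsets N)

countSubsets-complement : (N : ℕ) (P : Subset N → Bool) →
                          countSubsets N (not ∘ P) + countSubsets N P ≡ 2 ^ N
countSubsets-complement N P = begin
  countSubsets N (not ∘ P) + countSubsets N P
    ≡⟨ count-additive {r = λ _ → true} {s = λ _ → false} pointwise (allSubsets N) ⟩
  countSubsets N (λ _ → true) + countSubsets N (λ _ → false)
    ≡⟨ cong₂ _+_ (countSubsets-const N true) (countSubsets-const N false) ⟩
  1 * 2 ^ N + 0
    ≡⟨ trans (+-identityʳ _) (*-identityˡ _) ⟩
  2 ^ N ∎
  where
  open ≡-Reasoning
  pointwise : ∀ S → toℕ (not (P S)) + toℕ (P S) ≡ 1
  pointwise S with P S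
  ... | true  = refl
  ... | false = refl

countSubsets-ignoring-prefix : (r c : ℕ) {P : Subset (r + c) → Bool} {F : Subset c → Bool} →
                               ((v : Subset r) (w : Subset c) → P (v ++ᵥ w) ≡ F w) → countSubsets (r + c) P ≡ 2 ^ r * countSubsets c F
countSubsets-ignoring-prefix zero    c h = trans (countSubsets-cong c (h [])) (sym (+-identityʳ _))
countSubsets-ignoring-prefix (suc r) c {P} {F} h = begin
  countSubsets (suc r + c) P
    ≡⟨ countSubsets-suc (r + c) P ⟩
  countSubsets (r + c) (P ∘ (false ∷_)) + countSubsets (r + c) (P ∘ (true ∷_))
    ≡⟨ cong₂ _+_ (countSubsets-ignoring-prefix r c (λ v → h (false ∷ v)))
                 (countSubsets-ignoring-prefix r c (λ v → h (true ∷ v))) ⟩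
  2 ^ r * countSubsets c F + 2 ^ r * countSubsets c F
    ≡⟨ double (2 ^ r) (countSubsets c F) ⟩
  2 ^ suc r * countSubsets c F ∎
  where
  open ≡-Reasoning
  double : ∀ x y → x * y + x * y ≡ 2 * x * y
  double = solve-∀

countSubsets-ignoring-middle : (a r c : ℕ) {P : Subset (a + (r + c)) → Bool} {F : Subset (a + c) → Bool} →
                               ((u : Subset a) (v : Subset r) (w : Subset c) → P (u ++ᵥ (v ++ᵥ w)) ≡ F (u ++ᵥ w)) →
                               countSubsets (a + (r + c)) P ≡ 2 ^ r * countSubsets (a + c) F
countSubsets-ignoring-middle zero    r c h = countSubsets-ignoring-prefix r c (h [])
countSubsets-ignoring-middle (suc a) r c {P} {F} h = begin
  countSubsets (suc a + (r + c)) P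
    ≡⟨ countSubsets-suc (a + (r + c)) P ⟩
  countSubsets (a + (r + c)) (P ∘ (false ∷_)) + countSubsets (a + (r + c)) (P ∘ (true ∷_))
    ≡⟨ cong₂ _+_ (countSubsets-ignoring-middle a r c (λ u → h (false ∷ u)))
                 (countSubsets-ignoring-middle a r c (λ u → h (true ∷ u))) ⟩
  2 ^ r * countSubsets (a + c) (F ∘ (false ∷_)) + 2 ^ r * countSubsets (a + c) (F ∘ (true ∷_))
    ≡⟨ sym (*-distribˡ-+ (2 ^ r) _ _) ⟩
  2 ^ r * (countSubsets (a + c) (F ∘ (false ∷_)) + countSubsets (a + c) (F ∘ (true ∷_)))
    ≡⟨ cong (2 ^ r *_) (sym (countSubsets-suc (a + c) F)) ⟩
  2 ^ r * countSubsets (suc a + c) F ∎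
  where open ≡-Reasoning

DeterminedBy : {N : ℕ} → (ℕ → Bool) → (Subset N → Bool) → Set
DeterminedBy A P = ∀ S S′ → (∀ p → T (A p) → elem S p ≡ elem S′ p) → P S ≡ P S′

Disjoint : (ℕ → Bool) → (ℕ → Bool) → Set
Disjoint A B = ∀ p → T (A p) → T (B p) → ⊥

module _ {N : ℕ} {A : ℕ → Bool} {P : Subset (suc N) → Bool} (P-det : DeterminedBy A P) where

  DeterminedBy-tail : (b : Bool) → DeterminedBy (A ∘ suc) (P ∘ (b ∷_))
  DeterminedBy-tail b S S′ h = P-det (b ∷ S) (b ∷ S′) λ { zero _ → refl ; (suc p) a → h p a }

  ignores-head : A 0 ≡ false → ∀ S → P (true ∷ S) ≡ P (false ∷ S)
  ignores-head a0 S = P-det (true ∷ S) (false ∷ S) λ { zero a → ⊥-elim (subst T a0 a) ; (suc p) _ → refl }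

countSubsets-independent : {N : ℕ} {A B : ℕ → Bool} {P Q : Subset N → Bool} →
                           Disjoint A B → DeterminedBy A P → DeterminedBy B Q →
                           countSubsets N (λ S → P S ∧ Q S) * 2 ^ N ≡ countSubsets N P * countSubsets N Q

-- The induction step when P does not read the first position; the other case is symmetric.
countSubsets-independent-headless : {N : ℕ} {A B : ℕ → Bool} {P Q : Subset (suc N) → Bool} →
                                    Disjoint A B → DeterminedBy A P → DeterminedBy B Q → A 0 ≡ false →
                                    countSubsets (suc N) (λ S → P S ∧ Q S) * 2 ^ suc N
                                      ≡ countSubsets (suc N) P * countSubsets (suc N) Q

countSubsets-independent {zero} {P = P} {Q} _ _ _ with P [] | Q []
... | true  | true  = refl
... | true  | false = refl
... | false | _     = refl
countSubsets-independent {suc N} {A} {B} {P} {Q} AB P-det Q-det with A 0 in a0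
... | false = countSubsets-independent-headless AB P-det Q-det a0
... | true  = begin
  countSubsets (suc N) (λ S → P S ∧ Q S) * 2 ^ suc N
    ≡⟨ cong (_* 2 ^ suc N) (countSubsets-cong (suc N) (λ S → ∧-comm (P S) (Q S))) ⟩
  countSubsets (suc N) (λ S → Q S ∧ P S) * 2 ^ suc N
    ≡⟨ countSubsets-independent-headless (λ p b a → AB p a b) Q-det P-det b0 ⟩
  countSubsets (suc N) Q * countSubsets (suc N) P
    ≡⟨ *-comm (countSubsets (suc N) Q) (countSubsets (suc N) P) ⟩
  countSubsets (suc N) P * countSubsets (suc N) Q ∎
  where
  open ≡-Reasoning
  b0 : B 0 ≡ false
  b0 with B 0 in b0
  ... | false = refl
  ... | true  = ⊥-elim (AB 0 (subst T (sym a0) tt) (subst T (sym b0) tt))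

countSubsets-independent-headless {N} {A} {B} {P} {Q} AB P-det Q-det a0 = begin
  countSubsets (suc N) (λ S → P S ∧ Q S) * 2 ^ suc N
    ≡⟨ cong (_* 2 ^ suc N) (countSubsets-suc N _) ⟩
  (c false + countSubsets N (λ S → P (true ∷ S) ∧ Q (true ∷ S))) * 2 ^ suc N
    ≡⟨ cong (λ z → (c false + z) * 2 ^ suc N)
            (countSubsets-cong N (λ S → cong (_∧ Q (true ∷ S)) (ignores-head P-det a0 S))) ⟩
  (c false + c true) * (2 * 2 ^ N)
    ≡⟨ distribute (c false) (c true) (2 ^ N) ⟩
  2 * (c false * 2 ^ N + c true * 2 ^ N)
    ≡⟨ cong₂ (λ x y → 2 * (x + y)) (tail-independent false) (tail-independent true) ⟩
  2 * (p₀ * q false + p₀ * q true)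
    ≡⟨ factor p₀ (q false) (q true) ⟩
  (p₀ + p₀) * (q false + q true)
    ≡⟨ cong₂ _*_ (cong (p₀ +_) (countSubsets-cong N (λ S → sym (ignores-head P-det a0 S))))
                 (sym (countSubsets-suc N Q)) ⟩
  (p₀ + countSubsets N (P ∘ (true ∷_))) * countSubsets (suc N) Q
    ≡⟨ cong (_* countSubsets (suc N) Q) (sym (countSubsets-suc N P)) ⟩
  countSubsets (suc N) P * countSubsets (suc N) Q ∎
  where
  open ≡-Reasoning
  P₀ : Subset N → Bool
  P₀ = P ∘ (false ∷_)
  c : Bool → ℕ
  c b = countSubsets N (λ S → P₀ S ∧ Q (b ∷ S))
  p₀ : ℕ
  p₀ = countSubsets N P₀
  q : Bool → ℕ
  q b = countSubsets N (Q ∘ (b ∷_))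
  tail-independent : (b : Bool) → c b * 2 ^ N ≡ p₀ * q b
  tail-independent b = countSubsets-independent (λ p → AB (suc p)) (DeterminedBy-tail P-det false) (DeterminedBy-tail Q-det b)
  distribute : ∀ x y t → (x + y) * (2 * t) ≡ 2 * (x * t + y * t)
  distribute = solve-∀
  factor : ∀ p q q′ → 2 * (p * q + p * q′) ≡ (p + p) * (q + q′)
  factor = solve-∀

-- Independent clauses

data Clause : Set where
  present absent : ℕ → Clause
  notBoth        : ℕ → ℕ → Clause

positions : Clause → List ℕ
positions (present p)   = p ∷ []
positions (absent p)    = p ∷ []
positions (notBoth p q) = p ∷ q ∷ []

holds : {N : ℕ} → Clause → Subset N → Bool
holds (present p)   S = elem S p
holds (absent p)    S = not (elem S p)
holds (notBoth p q) S = not (elem S p ∧ elem S q)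

-- A uniform subset satisfies c with probability numerator c / denominator c.
numerator denominator : Clause → ℕ
numerator (notBoth _ _) = 3
numerator _             = 1
denominator (notBoth _ _) = 4
denominator _             = 2

Valid : ℕ → Clause → Set
Valid N (present p)   = p < N
Valid N (absent p)    = p < N
Valid N (notBoth p q) = p < N × q < N × p ≢ q

Apart : Clause → Clause → Set
Apart c c′ = All (λ p → All (p ≢_) (positions c′)) (positions c)

reads : Clause → ℕ → Bool
reads c x = any (x ≡ᵇ_) (positions c)

∈⇒reads : {x : ℕ} (c : Clause) → x ∈ positions c → T (reads c x)
∈⇒reads {x} c x∈ = any⁺ (x ≡ᵇ_) (Any.map (≡⇒≡ᵇ x _) x∈)

reads⇒∈ : {x : ℕ} (c : Clause) → T (reads c x) → x ∈ positions c
reads⇒∈ {x} c r = Any.map (≡ᵇ⇒≡ x _) (any⁻ (x ≡ᵇ_) (positions c) r)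

Apart⇒Disjoint : {c c′ : Clause} → Apart c c′ → Disjoint (reads c) (reads c′)
Apart⇒Disjoint {c} {c′} ap x r r′ = All.lookup (All.lookup ap (reads⇒∈ {x} c r)) (reads⇒∈ {x} c′ r′) refl

holds-determined : {N : ℕ} (c : Clause) → DeterminedBy {N} (reads c) (holds c)
holds-determined c@(present p)   S S′ h = h p (∈⇒reads c (here refl))
holds-determined c@(absent p)    S S′ h = cong not (h p (∈⇒reads c (here refl)))
holds-determined c@(notBoth p q) S S′ h =
  cong not (cong₂ _∧_ (h p (∈⇒reads c (here refl))) (h q (∈⇒reads c (there (here refl)))))

holdsAll : {N : ℕ} → List Clause → Subset N → Bool
holdsAll []       S = true
holdsAll (c ∷ cs) S = holds c S ∧ holdsAll cs S

readsAll : List Clause → ℕ → Bool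
readsAll cs x = any (λ c → reads c x) cs

numeratorAll denominatorAll : List Clause → ℕ
numeratorAll []         = 1
numeratorAll (c ∷ cs)   = numerator c * numeratorAll cs
denominatorAll []       = 1
denominatorAll (c ∷ cs) = denominator c * denominatorAll cs

Independent : ℕ → List Clause → Set
Independent N cs = All (Valid N) cs × AllPairs Apart cs

holdsAll-determined : {N : ℕ} (cs : List Clause) → DeterminedBy {N} (readsAll cs) (holdsAll cs)
holdsAll-determined []       S S′ h = refl
holdsAll-determined (c ∷ cs) S S′ h =
  cong₂ _∧_ (holds-determined c S S′ λ p r → h p (Equivalence.from T-∨ (inj₁ r)))
            (holdsAll-determined cs S S′ λ p r → h p (Equivalence.from T-∨ (inj₂ r)))

All-Apart⇒Disjoint : {c : Clause} {cs : List Clause} → All (Apart c) cs → Disjoint (reads c) (readsAll cs)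
All-Apart⇒Disjoint {c} {cs} aps x r rs with All.lookupAny aps (any⁻ (λ c′ → reads c′ x) cs rs)
... | ap , r′ = Apart⇒Disjoint ap x r r′

countSubsets-elem : (N p : ℕ) → p < N → countSubsets N (λ S → elem S p) * 2 ≡ 2 ^ N
countSubsets-elem (suc N) zero _ = begin
  countSubsets (suc N) (λ S → elem S 0) * 2
    ≡⟨ cong (_* 2) (countSubsets-suc N _) ⟩
  (countSubsets N (λ _ → false) + countSubsets N (λ _ → true)) * 2
    ≡⟨ cong₂ (λ x y → (x + y) * 2) (countSubsets-const N false) (countSubsets-const N true) ⟩
  (0 * 2 ^ N + 1 * 2 ^ N) * 2
    ≡⟨ arith (2 ^ N) ⟩
  2 ^ suc N ∎
  where
  open ≡-Reasoning
  arith : ∀ t → (0 * t + 1 * t) * 2 ≡ 2 * t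
  arith = solve-∀
countSubsets-elem (suc N) (suc p) (s≤s p<N) = begin
  countSubsets (suc N) (λ S → elem S (suc p)) * 2
    ≡⟨ cong (_* 2) (countSubsets-suc N _) ⟩
  (c + c) * 2
    ≡⟨ arith c ⟩
  2 * (c * 2)
    ≡⟨ cong (2 *_) (countSubsets-elem N p p<N) ⟩
  2 ^ suc N ∎
  where
  open ≡-Reasoning
  c : ℕ
  c = countSubsets N (λ S → elem S p)
  arith : ∀ c → (c + c) * 2 ≡ 2 * (c * 2)
  arith = solve-∀

countSubsets-holds : (N : ℕ) (c : Clause) → Valid N c → countSubsets N (holds c) * denominator c ≡ numerator c * 2 ^ N
countSubsets-holds N (present p) p<N = trans (countSubsets-elem N p p<N) (sym (*-identityˡ _))
countSubsets-holds N (absent p) p<N = trans (cong (_* 2) absent≡present)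
                                            (trans (countSubsets-elem N p p<N) (sym (*-identityˡ _)))
  where
  c : ℕ
  c = countSubsets N (λ S → elem S p)
  absent≡present : countSubsets N (not ∘ λ S → elem S p) ≡ c
  absent≡present = +-cancelʳ-≡ c _ c (begin
    countSubsets N (not ∘ λ S → elem S p) + c ≡⟨ countSubsets-complement N (λ S → elem S p) ⟩
    2 ^ N                                   ≡⟨ sym (countSubsets-elem N p p<N) ⟩
    c * 2                                   ≡⟨ twice c ⟩
    c + c                                   ∎)
    where
    open ≡-Reasoning
    twice : ∀ c → c * 2 ≡ c + c
    twice = solve-∀
countSubsets-holds N (notBoth p q) (p<N , q<N , p≢q) = +-cancelʳ-≡ (2 ^ N) _ _ (begin
  x * 4 + 2 ^ N    ≡⟨ cong (x * 4 +_) (sym both) ⟩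
  x * 4 + b * 4    ≡⟨ sym (*-distribʳ-+ 4 x b) ⟩
  (x + b) * 4      ≡⟨ cong (_* 4) (countSubsets-complement N _) ⟩
  2 ^ N * 4        ≡⟨ arith (2 ^ N) ⟩
  3 * 2 ^ N + 2 ^ N ∎)
  where
  open ≡-Reasoning
  b x : ℕ
  b = countSubsets N (λ S → elem S p ∧ elem S q)
  x = countSubsets N (λ S → not (elem S p ∧ elem S q))
  arith : ∀ t → t * 4 ≡ 3 * t + t
  arith = solve-∀
  independent : b * 2 ^ N ≡ countSubsets N (λ S → elem S p) * countSubsets N (λ S → elem S q)
  independent = countSubsets-independent {N} (Apart⇒Disjoint {present p} {present q} ((p≢q ∷ []) ∷ []))
                                         (holds-determined (present p)) (holds-determined (present q))
  both : b * 4 ≡ 2 ^ N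
  both = *-cancelʳ-≡ _ _ (2 ^ N) {{m^n≢0 2 N}} (begin
    b * 4 * 2 ^ N
      ≡⟨ regroup b (2 ^ N) ⟩
    b * 2 ^ N * 4
      ≡⟨ cong (_* 4) independent ⟩
    cp * cq * 4
      ≡⟨ halve cp cq ⟩
    (cp * 2) * (cq * 2)
      ≡⟨ cong₂ _*_ (countSubsets-elem N p p<N) (countSubsets-elem N q q<N) ⟩
    2 ^ N * 2 ^ N ∎)
    where
    cp cq : ℕ
    cp = countSubsets N (λ S → elem S p)
    cq = countSubsets N (λ S → elem S q)
    regroup : ∀ b t → b * 4 * t ≡ b * t * 4
    regroup = solve-∀
    halve : ∀ x y → x * y * 4 ≡ (x * 2) * (y * 2)
    halve = solve-∀

countSubsets-holdsAll : (N : ℕ) (cs : List Clause) → Independent N cs →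
                        countSubsets N (holdsAll cs) * denominatorAll cs ≡ numeratorAll cs * 2 ^ N
countSubsets-holdsAll N []       _ = trans (*-identityʳ _) (trans (countSubsets-const N true) refl)
countSubsets-holdsAll N (c ∷ cs) (valid ∷ valids , apart ∷ aparts) = *-cancelʳ-≡ _ _ (2 ^ N) {{m^n≢0 2 N}} (begin
  x * (d * ds) * 2 ^ N            ≡⟨ regroup₁ x d ds (2 ^ N) ⟩
  (x * 2 ^ N) * (d * ds)          ≡⟨ cong (_* (d * ds)) independent ⟩
  (y * z) * (d * ds)              ≡⟨ regroup₂ y z d ds ⟩
  (y * d) * (z * ds)              ≡⟨ cong₂ _*_ (countSubsets-holds N c valid) (countSubsets-holdsAll N cs (valids , aparts)) ⟩
  (n * 2 ^ N) * (ns * 2 ^ N)      ≡⟨ regroup₃ n ns (2 ^ N) ⟩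
  n * ns * 2 ^ N * 2 ^ N ∎)
  where
  open ≡-Reasoning
  x y z d ds n ns : ℕ
  x = countSubsets N (holdsAll (c ∷ cs))
  y = countSubsets N (holds c)
  z = countSubsets N (holdsAll cs)
  d = denominator c
  ds = denominatorAll cs
  n = numerator c
  ns = numeratorAll cs
  independent : x * 2 ^ N ≡ y * z
  independent = countSubsets-independent {N} (All-Apart⇒Disjoint apart) (holds-determined c) (holdsAll-determined cs)
  regroup₁ : ∀ x d ds t → x * (d * ds) * t ≡ (x * t) * (d * ds)
  regroup₁ = solve-∀
  regroup₂ : ∀ y z d ds → (y * z) * (d * ds) ≡ (y * d) * (z * ds)
  regroup₂ = solve-∀
  regroup₃ : ∀ n ns t → (n * t) * (ns * t) ≡ n * ns * t * t
  regroup₃ = solve-∀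

holdsAll-applyUpTo : {N : ℕ} (f : ℕ → Clause) (k : ℕ) (S : Subset N) →
                     (∀ i → i < k → holds (f i) S ≡ true) → holdsAll (applyUpTo f k) S ≡ true
holdsAll-applyUpTo f zero    S h = refl
holdsAll-applyUpTo f (suc k) S h = cong₂ _∧_ (h 0 z<s) (holdsAll-applyUpTo (f ∘ suc) k S (λ i → h (suc i) ∘ s<s))

holdsAll-applyUpTo⁻ : {N : ℕ} (f : ℕ → Clause) (k : ℕ) (S : Subset N) →
                      holdsAll (applyUpTo f k) S ≡ true → ∀ i → i < k → holds (f i) S ≡ true
holdsAll-applyUpTo⁻ f (suc k) S h zero    _         = ∧-conicalˡ _ _ h
holdsAll-applyUpTo⁻ f (suc k) S h (suc i) (s<s i<k) = holdsAll-applyUpTo⁻ (f ∘ suc) k S (∧-conicalʳ (holds (f 0) S) _ h) i i<k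

Independent-∷ : {N : ℕ} {c : Clause} {cs : List Clause} → Valid N c → All (Apart c) cs → Independent N cs → Independent N (c ∷ cs)
Independent-∷ valid apart (valids , aparts) = valid ∷ valids , apart ∷ aparts

pairs : ℕ → (ℕ → ℕ) → ℕ → List Clause
pairs d a k = applyUpTo (λ i → notBoth (a i) (a i + d)) k

numeratorAll-pairs : (d : ℕ) (a : ℕ → ℕ) (k : ℕ) → numeratorAll (pairs d a k) ≡ 3 ^ k
numeratorAll-pairs d a zero    = refl
numeratorAll-pairs d a (suc k) = cong (3 *_) (numeratorAll-pairs d (a ∘ suc) k)

denominatorAll-pairs : (d : ℕ) (a : ℕ → ℕ) (k : ℕ) → denominatorAll (pairs d a k) ≡ 4 ^ k
denominatorAll-pairs d a zero    = refl
denominatorAll-pairs d a (suc k) = cong (4 *_) (denominatorAll-pairs d (a ∘ suc) k)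

denominatorAll≢0 : (cs : List Clause) → NonZero (denominatorAll cs)
denominatorAll≢0 []                  = _
denominatorAll≢0 (present _ ∷ cs)    = m*n≢0 2 _ {{_}} {{denominatorAll≢0 cs}}
denominatorAll≢0 (absent _ ∷ cs)     = m*n≢0 2 _ {{_}} {{denominatorAll≢0 cs}}
denominatorAll≢0 (notBoth _ _ ∷ cs)  = m*n≢0 4 _ {{_}} {{denominatorAll≢0 cs}}

-- Difference sets

anyBelow : ℕ → (ℕ → Bool) → Bool
anyBelow zero    f = false
anyBelow (suc k) f = f 0 ∨ anyBelow k (f ∘ suc)

countBelow : ℕ → (ℕ → Bool) → ℕ
countBelow zero    f = 0
countBelow (suc k) f = toℕ (f 0) + countBelow k (f ∘ suc)

any-applyUpTo : (p : ℕ → Bool) (g : ℕ → ℕ) (k : ℕ) → any p (applyUpTo g k) ≡ anyBelow k (p ∘ g)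
any-applyUpTo p g zero    = refl
any-applyUpTo p g (suc k) = cong (p (g 0) ∨_) (any-applyUpTo p (g ∘ suc) k)

count-applyUpTo : (p : ℕ → Bool) (g : ℕ → ℕ) (k : ℕ) → count p (applyUpTo g k) ≡ countBelow k (p ∘ g)
count-applyUpTo p g zero    = refl
count-applyUpTo p g (suc k) = trans (count-∷ p (g 0) _) (cong (toℕ (p (g 0)) +_) (count-applyUpTo p (g ∘ suc) k))

anyBelow-cong : (k : ℕ) {f g : ℕ → Bool} → (∀ i → i < k → f i ≡ g i) → anyBelow k f ≡ anyBelow k g
anyBelow-cong zero    h = refl
anyBelow-cong (suc k) h = cong₂ _∨_ (h 0 z<s) (anyBelow-cong k (λ i → h (suc i) ∘ s<s))

countBelow-cong : (k : ℕ) {f g : ℕ → Bool} → (∀ i → i < k → f i ≡ g i) → countBelow k f ≡ countBelow k g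
countBelow-cong zero    h = refl
countBelow-cong (suc k) h = cong₂ _+_ (cong toℕ (h 0 z<s)) (countBelow-cong k (λ i → h (suc i) ∘ s<s))

anyBelow-witness : (k : ℕ) (f : ℕ → Bool) → anyBelow k f ≡ true → Σ ℕ λ i → i < k × f i ≡ true
anyBelow-witness (suc k) f h with f 0 in f0
... | true  = 0 , z<s , f0
... | false with anyBelow-witness k (f ∘ suc) h
...   | i , i<k , fi = suc i , s<s i<k , fi

anyBelow-intro : (k : ℕ) (f : ℕ → Bool) {i : ℕ} → i < k → f i ≡ true → anyBelow k f ≡ true
anyBelow-intro (suc k) f {zero}  _         fi = cong (_∨ anyBelow k (f ∘ suc)) fi
anyBelow-intro (suc k) f {suc i} (s<s i<k) fi =
  trans (cong (f 0 ∨_) (anyBelow-intro k (f ∘ suc) i<k fi)) (∨-zeroʳ (f 0))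

anyBelow-false : (k : ℕ) (f : ℕ → Bool) → anyBelow k f ≡ false → ∀ {i} → i < k → f i ≡ false
anyBelow-false k f h {i} i<k with f i in fi
... | false = refl
... | true  with () ← trans (sym (anyBelow-intro k f i<k fi)) h

anyBelow-allFalse : (k : ℕ) {f : ℕ → Bool} → (∀ i → i < k → f i ≡ false) → anyBelow k f ≡ false
anyBelow-allFalse k h = trans (anyBelow-cong k h) (constFalse k)
  where
  constFalse : ∀ k → anyBelow k (λ _ → false) ≡ false
  constFalse zero    = refl
  constFalse (suc k) = constFalse k

anyBelow-+ : (a b : ℕ) (f : ℕ → Bool) → anyBelow (a + b) f ≡ anyBelow a f ∨ anyBelow b (λ i → f (a + i))
anyBelow-+ zero    b f = refl
anyBelow-+ (suc a) b f = trans (cong (f 0 ∨_) (anyBelow-+ a b (f ∘ suc))) (sym (∨-assoc (f 0) _ _))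

anyBelow-truncate : {b n : ℕ} (f : ℕ → Bool) → b ≤ n → (∀ y → b ≤ y → f y ≡ false) → anyBelow n f ≡ anyBelow b f
anyBelow-truncate {b} {n} f b≤n h = begin
  anyBelow n f                                           ≡⟨ cong (λ k → anyBelow k f) (sym (m+[n∸m]≡n b≤n)) ⟩
  anyBelow (b + (n ∸ b)) f                               ≡⟨ anyBelow-+ b (n ∸ b) f ⟩
  anyBelow b f ∨ anyBelow (n ∸ b) (λ i → f (b + i))      ≡⟨ cong (anyBelow b f ∨_) (anyBelow-allFalse (n ∸ b) (λ i _ → h (b + i) (m≤m+n b i))) ⟩
  anyBelow b f ∨ false                                   ≡⟨ ∨-identityʳ _ ⟩
  anyBelow b f                                           ∎
  where open ≡-Reasoning

countBelow-+ : (a b : ℕ) (f : ℕ → Bool) → countBelow (a + b) f ≡ countBelow a f + countBelow b (λ i → f (a + i))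
countBelow-+ zero    b f = refl
countBelow-+ (suc a) b f = trans (cong (toℕ (f 0) +_) (countBelow-+ a b (f ∘ suc))) (sym (+-assoc (toℕ (f 0)) _ _))

countBelow-reverse : (k : ℕ) (f : ℕ → Bool) → countBelow k f ≡ countBelow k (λ i → f (k ∸ suc i))
countBelow-reverse zero    f = refl
countBelow-reverse (suc k) f = begin
  countBelow (suc k) f                              ≡⟨ cong (λ j → countBelow j f) (+-comm 1 k) ⟩
  countBelow (k + 1) f                              ≡⟨ countBelow-+ k 1 f ⟩
  countBelow k f + (toℕ (f (k + 0)) + 0)            ≡⟨ cong₂ _+_ (countBelow-reverse k f) (trans (+-identityʳ _) (cong (toℕ ∘ f) (+-identityʳ k))) ⟩
  countBelow k (λ i → f (k ∸ suc i)) + toℕ (f k)    ≡⟨ +-comm _ (toℕ (f k)) ⟩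
  countBelow (suc k) (λ i → f (suc k ∸ suc i))      ∎
  where open ≡-Reasoning

countBelow-complement : (k : ℕ) (f : ℕ → Bool) → countBelow k f + countBelow k (not ∘ f) ≡ k
countBelow-complement zero    f = refl
countBelow-complement (suc k) f with f 0
... | true  = cong suc (countBelow-complement k (f ∘ suc))
... | false = trans (+-suc _ _) (cong suc (countBelow-complement k (f ∘ suc)))

countBelow-≤ : (k : ℕ) (f : ℕ → Bool) → countBelow k f ≤ k
countBelow-≤ k f = subst (countBelow k f ≤_) (countBelow-complement k f) (m≤m+n _ _)

countBelow-allFalse : (k : ℕ) {f : ℕ → Bool} → (∀ i → i < k → f i ≡ false) → countBelow k f ≡ 0
countBelow-allFalse k h = trans (countBelow-cong k h) (constFalse k)
  where
  constFalse : ∀ k → countBelow k (λ _ → false) ≡ 0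
  constFalse zero    = refl
  constFalse (suc k) = constFalse k

countBelow-∸ : (k : ℕ) (f : ℕ → Bool) → k ∸ countBelow k f ≡ countBelow k (not ∘ f)
countBelow-∸ k f = trans (cong (_∸ countBelow k f) (sym (countBelow-complement k f))) (m+n∸m≡n (countBelow k f) _)

elem-≥ : {n : ℕ} (S : Subset n) {x : ℕ} → n ≤ x → elem S x ≡ false
elem-≥ []      _         = refl
elem-≥ (b ∷ S) (s≤s n≤x) = elem-≥ S n≤x

elem⇒< : {n : ℕ} (S : Subset n) {x : ℕ} → elem S x ≡ true → x < n
elem⇒< {n} S {x} ex with x <? n
... | yes x<n = x<n
... | no  x≮n with () ← trans (sym ex) (elem-≥ S (≮⇒≥ x≮n))

elem-++ˡ : {a b : ℕ} (u : Subset a) (v : Subset b) {x : ℕ} → x < a → elem (u ++ᵥ v) x ≡ elem u x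
elem-++ˡ (s ∷ u) v {zero}  _         = refl
elem-++ˡ (s ∷ u) v {suc x} (s<s x<a) = elem-++ˡ u v x<a

elem-++ʳ : {a b : ℕ} (u : Subset a) (v : Subset b) (z : ℕ) → elem (u ++ᵥ v) (a + z) ≡ elem v z
elem-++ʳ []      v z = refl
elem-++ʳ (s ∷ u) v z = elem-++ʳ u v z

hasDifference : {n : ℕ} → Subset n → ℕ → Bool
hasDifference {n} S d = anyBelow n (λ y → elem S y ∧ elem S (y + d))

hasDifference-witness : {n : ℕ} (S : Subset n) (d : ℕ) → hasDifference S d ≡ true →
                        Σ ℕ λ y → elem S y ≡ true × elem S (y + d) ≡ true
hasDifference-witness {n} S d h with anyBelow-witness n _ h
... | y , _ , e = y , ∧-conicalˡ _ _ e , ∧-conicalʳ _ _ e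

hasDifference-intro : {n : ℕ} (S : Subset n) {y d : ℕ} → elem S y ≡ true → elem S (y + d) ≡ true → hasDifference S d ≡ true
hasDifference-intro {n} S {y} ey eyd = anyBelow-intro n _ (elem⇒< S ey) (cong₂ _∧_ ey eyd)

inDiff-witness : {n : ℕ} (S : Subset n) (z : ℤ) → inDiff S z ≡ true →
                 Σ ℕ λ x → Σ ℕ λ y → elem S x ≡ true × elem S y ≡ true × (ℤ.+ x) ℤ.- (ℤ.+ y) ≡ z
inDiff-witness {n} S z h with anyBelow-witness n _ (trans (sym (any-applyUpTo _ (λ i → i) n)) h)
... | x , _ , hx with anyBelow-witness n _ (trans (sym (any-applyUpTo _ (λ i → i) n)) hx)
... | y , _ , hy = x , y , ∧-conicalˡ (elem S x) _ hy , ∧-conicalˡ (elem S y) _ rest , does-≟ (∧-conicalʳ (elem S y) _ rest)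
  where
  rest : (elem S y ∧ does ((ℤ.+ x) ℤ.- (ℤ.+ y) ℤ.≟ z)) ≡ true
  rest = ∧-conicalʳ (elem S x) _ hy
  does-≟ : {a b : ℤ} → does (a ℤ.≟ b) ≡ true → a ≡ b
  does-≟ {a} {b} h with a ℤ.≟ b
  ... | yes a≡b = a≡b

inDiff-intro : {n : ℕ} (S : Subset n) {z : ℤ} (x y : ℕ) → elem S x ≡ true → elem S y ≡ true →
               (ℤ.+ x) ℤ.- (ℤ.+ y) ≡ z → inDiff S z ≡ true
inDiff-intro {n} S {z} x y ex ey e = trans (any-applyUpTo _ (λ i → i) n)
  (anyBelow-intro n _ (elem⇒< S ex) (trans (any-applyUpTo _ (λ i → i) n)
    (anyBelow-intro n _ (elem⇒< S ey) pair-holds)))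
  where
  pair-holds : (elem S x ∧ elem S y ∧ does ((ℤ.+ x) ℤ.- (ℤ.+ y) ℤ.≟ z)) ≡ true
  pair-holds rewrite ex | ey with (ℤ.+ x) ℤ.- (ℤ.+ y) ℤ.≟ z
  ... | yes _  = refl
  ... | no  ne = ⊥-elim (ne e)

private
  cancel-right : ∀ a b → a ≡ (a ℤ.- b) ℤ.+ b
  cancel-right = ℤ-Solver.solve-∀
  cancel-left : ∀ a b → b ≡ a ℤ.- (a ℤ.- b)
  cancel-left = ℤ-Solver.solve-∀
  add-sub : ∀ a b → (a ℤ.+ b) ℤ.- a ≡ b
  add-sub = ℤ-Solver.solve-∀
  sub-add : ∀ a b → a ℤ.- (a ℤ.+ b) ≡ ℤ.- b
  sub-add = ℤ-Solver.solve-∀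

difference-+ : (x y d : ℕ) → (ℤ.+ x) ℤ.- (ℤ.+ y) ≡ ℤ.+ d → x ≡ y + d
difference-+ x y d e = ℤ.+-injective (begin
  ℤ.+ x                     ≡⟨ cancel-right (ℤ.+ x) (ℤ.+ y) ⟩
  (ℤ.+ x ℤ.- ℤ.+ y) ℤ.+ ℤ.+ y   ≡⟨ cong (ℤ._+ ℤ.+ y) e ⟩
  ℤ.+ d ℤ.+ ℤ.+ y             ≡⟨ sym (ℤ.pos-+ d y) ⟩
  ℤ.+ (d + y)               ≡⟨ cong ℤ.+_ (+-comm d y) ⟩
  ℤ.+ (y + d)               ∎)
  where open ≡-Reasoning

difference-- : (x y e : ℕ) → (ℤ.+ x) ℤ.- (ℤ.+ y) ≡ -[1+ e ] → y ≡ x + suc e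
difference-- x y e eq = ℤ.+-injective (begin
  ℤ.+ y                     ≡⟨ cancel-left (ℤ.+ x) (ℤ.+ y) ⟩
  ℤ.+ x ℤ.- (ℤ.+ x ℤ.- ℤ.+ y)   ≡⟨ cong (λ z → ℤ.+ x ℤ.- z) eq ⟩
  ℤ.+ x ℤ.+ ℤ.+ suc e         ≡⟨ sym (ℤ.pos-+ x (suc e)) ⟩
  ℤ.+ (x + suc e)           ∎)
  where open ≡-Reasoning

difference-+-intro : (y d : ℕ) → (ℤ.+ (y + d)) ℤ.- (ℤ.+ y) ≡ ℤ.+ d
difference-+-intro y d = trans (cong (ℤ._- ℤ.+ y) (ℤ.pos-+ y d)) (add-sub (ℤ.+ y) (ℤ.+ d))

difference---intro : (x e : ℕ) → (ℤ.+ x) ℤ.- (ℤ.+ (x + suc e)) ≡ -[1+ e ]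
difference---intro x e = trans (cong (λ z → ℤ.+ x ℤ.- z) (ℤ.pos-+ x (suc e))) (sub-add (ℤ.+ x) (ℤ.+ suc e))

Bool-ext : {a b : Bool} → (a ≡ true → b ≡ true) → (b ≡ true → a ≡ true) → a ≡ b
Bool-ext {false} {false} _ _ = refl
Bool-ext {false} {true}  _ g = g refl
Bool-ext {true}          f _ = sym (f refl)

inDiff-+ : {n : ℕ} (S : Subset n) (d : ℕ) → inDiff S (ℤ.+ d) ≡ hasDifference S d
inDiff-+ S d = Bool-ext to from
  where
  to : inDiff S (ℤ.+ d) ≡ true → hasDifference S d ≡ true
  to h with inDiff-witness S (ℤ.+ d) h
  ... | x , y , ex , ey , e = hasDifference-intro S ey (subst (λ z → elem S z ≡ true) (difference-+ x y d e) ex)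
  from : hasDifference S d ≡ true → inDiff S (ℤ.+ d) ≡ true
  from h with hasDifference-witness S d h
  ... | y , ey , eyd = inDiff-intro S (y + d) y eyd ey (difference-+-intro y d)

inDiff-- : {n : ℕ} (S : Subset n) (e : ℕ) → inDiff S -[1+ e ] ≡ hasDifference S (suc e)
inDiff-- S e = Bool-ext to from
  where
  to : inDiff S -[1+ e ] ≡ true → hasDifference S (suc e) ≡ true
  to h with inDiff-witness S -[1+ e ] h
  ... | x , y , ex , ey , eq = hasDifference-intro S ex (subst (λ z → elem S z ≡ true) (difference-- x y e eq) ey)
  from : hasDifference S (suc e) ≡ true → inDiff S -[1+ e ] ≡ true
  from h with hasDifference-witness S (suc e) h
  ... | y , ey , eyd = inDiff-intro S y (y + suc e) ey eyd (difference---intro y e)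

missingDifferences : {n : ℕ} → Subset n → ℕ
missingDifferences {n} S = countBelow (n ∸ 1) (λ i → not (hasDifference S (suc i)))

diffSetSize-countBelow : {n : ℕ} (S : Subset (suc n)) →
                         diffSetSize S ≡ countBelow (n + suc n) (λ i → inDiff S (ℤ.+ i ℤ.- ℤ.+ n))
diffSetSize-countBelow {n} S = begin
  diffSetSize S
    ≡⟨ count-map (inDiff S) (λ i → ℤ.+ i ℤ.- ℤ.+ n) (upTo (2 * suc n ∸ 1)) ⟩
  count (λ i → inDiff S (ℤ.+ i ℤ.- ℤ.+ n)) (upTo (n + (suc n + 0)))
    ≡⟨ count-applyUpTo (λ i → inDiff S (ℤ.+ i ℤ.- ℤ.+ n)) (λ i → i) (n + (suc n + 0)) ⟩
  countBelow (n + (suc n + 0)) (λ i → inDiff S (ℤ.+ i ℤ.- ℤ.+ n))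
    ≡⟨ cong (λ k → countBelow (n + k) (λ i → inDiff S (ℤ.+ i ℤ.- ℤ.+ n))) (+-identityʳ (suc n)) ⟩
  countBelow (n + suc n) (λ i → inDiff S (ℤ.+ i ℤ.- ℤ.+ n)) ∎
  where open ≡-Reasoning

-- Since S - S is symmetric and contains 0, |S - S| = 1 + 2 · #(positive differences).
diffSetSize-deficiency : {n : ℕ} (S : Subset (suc n)) → elem S 0 ≡ true →
                         (2 * suc n ∸ 1) ∸ diffSetSize S ≡ missingDifferences S + missingDifferences S
diffSetSize-deficiency {n} S 0∈S = begin
  (2 * suc n ∸ 1) ∸ diffSetSize S
    ≡⟨ cong₂ _∸_ (cong (n +_) (+-identityʳ (suc n))) (trans (diffSetSize-countBelow S) (countBelow-+ n (suc n) F)) ⟩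
  (n + suc n) ∸ (countBelow n F + countBelow (suc n) (λ i → F (n + i)))
    ≡⟨ cong₂ (λ a b → (n + suc n) ∸ (a + b)) negative positive ⟩
  (n + suc n) ∸ (P + suc P)
    ≡⟨ cong (λ z → (z + suc z) ∸ (P + suc P)) (sym (countBelow-complement n G)) ⟩
  ((P + M) + suc (P + M)) ∸ (P + suc P)
    ≡⟨ cong (_∸ (P + suc P)) (regroup P M) ⟩
  (M + M) + (P + suc P) ∸ (P + suc P)
    ≡⟨ m+n∸n≡m (M + M) (P + suc P) ⟩
  M + M ∎
  where
  open ≡-Reasoning
  F : ℕ → Bool
  F i = inDiff S (ℤ.+ i ℤ.- ℤ.+ n)
  G : ℕ → Bool
  G j = hasDifference S (suc j)
  P M : ℕ
  P = countBelow n G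
  M = missingDifferences S
  regroup : ∀ P M → (P + M) + suc (P + M) ≡ (M + M) + (P + suc P)
  regroup = solve-∀
  negative : countBelow n F ≡ P
  negative = trans (countBelow-cong n reflect) (sym (countBelow-reverse n G))
    where
    reflect : ∀ i → i < n → F i ≡ G (n ∸ suc i)
    reflect i i<n = trans (cong (inDiff S) -i) (inDiff-- S (n ∸ suc i))
      where
      -i : ℤ.+ i ℤ.- ℤ.+ n ≡ -[1+ n ∸ suc i ]
      -i = trans (cong (λ z → ℤ.+ i ℤ.- ℤ.+ z) (sym (trans (+-suc i _) (m+[n∸m]≡n i<n)))) (difference---intro i (n ∸ suc i))
  positive : countBelow (suc n) (λ i → F (n + i)) ≡ suc P
  positive = cong₂ _+_ (cong toℕ zero-difference)
                       (countBelow-cong n (λ j _ → trans (cong (inDiff S) (difference-+-intro n (suc j))) (inDiff-+ S (suc j))))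
    where
    zero-difference : F (n + 0) ≡ true
    zero-difference = trans (cong (inDiff S) (difference-+-intro n 0)) (trans (inDiff-+ S 0)
                        (hasDifference-intro S 0∈S (trans (cong (elem S) (+-identityʳ 0)) 0∈S)))

diffUpperSize-deficiency : {n : ℕ} (m : ℕ) (S : Subset n) →
                           m ∸ diffUpperSize m S ≡ countBelow m (λ i → not (hasDifference S (m + i)))
diffUpperSize-deficiency m S = begin
  m ∸ diffUpperSize m S
    ≡⟨ cong (m ∸_) (trans (count-applyUpTo (λ i → inDiff S (ℤ.+ (m + i))) (λ i → i) m) (countBelow-cong m (λ i _ → inDiff-+ S (m + i)))) ⟩
  m ∸ countBelow m (λ i → hasDifference S (m + i))
    ≡⟨ countBelow-∸ m _ ⟩
  countBelow m (λ i → not (hasDifference S (m + i))) ∎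
  where open ≡-Reasoning

diffUpperSize-≤ : {n : ℕ} (m : ℕ) (S : Subset n) → diffUpperSize m S ≤ m
diffUpperSize-≤ m S = subst (_≤ m) (sym (count-applyUpTo (λ i → inDiff S (ℤ.+ (m + i))) (λ i → i) m)) (countBelow-≤ m _)

frac : ℕ → (b : ℕ) → .{{NonZero b}} → ℚ
frac a b = ℤ.+ a ℚ./ b

ratio≡frac : (a b : ℕ) .{{_ : NonZero b}} → ratio a b ≡ frac a b
ratio≡frac a (suc b) = refl

private
  toℚᵘ-frac : (a b : ℕ) → toℚᵘ (frac a (suc b)) ≃ᵘ mkℚᵘ (ℤ.+ a) b
  toℚᵘ-frac a b = ℚ.toℚᵘ-fromℚᵘ (mkℚᵘ (ℤ.+ a) b)

  toℚᵘ-frac⁻¹ : (a b : ℕ) → mkℚᵘ (ℤ.+ a) b ≃ᵘ toℚᵘ (frac a (suc b))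
  toℚᵘ-frac⁻¹ a b = ℚᵘ.≃-sym (toℚᵘ-frac a b)

  pos-* : (a b : ℕ) → ℤ.+ a ℤ.* ℤ.+ b ≡ ℤ.+ (a * b)
  pos-* a b = sym (ℤ.pos-* a b)

frac-≤ : (a b c d : ℕ) .{{_ : NonZero b}} .{{_ : NonZero d}} → a * d ≤ c * b → frac a b ≤ℚ frac c d
frac-≤ a (suc b) c (suc d) le = ℚ.toℚᵘ-cancel-≤
  (ℚᵘ.≤-respʳ-≃ (toℚᵘ-frac⁻¹ c d) (ℚᵘ.≤-respˡ-≃ (toℚᵘ-frac⁻¹ a b)
    (*≤* (subst₂ ℤ._≤_ (sym (pos-* a (suc d))) (sym (pos-* c (suc b))) (ℤ.+≤+ le)))))

frac-< : (a b c d : ℕ) .{{_ : NonZero b}} .{{_ : NonZero d}} → a * d < c * b → frac a b <ℚ frac c d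
frac-< a (suc b) c (suc d) lt = ℚ.toℚᵘ-cancel-<
  (ℚᵘ.<-respʳ-≃ (toℚᵘ-frac⁻¹ c d) (ℚᵘ.<-respˡ-≃ (toℚᵘ-frac⁻¹ a b)
    (*<* (subst₂ ℤ._<_ (sym (pos-* a (suc d))) (sym (pos-* c (suc b))) (ℤ.+<+ lt)))))

frac-≡ : (a b c d : ℕ) .{{_ : NonZero b}} .{{_ : NonZero d}} → a * d ≡ c * b → frac a b ≡ frac c d
frac-≡ a b c d e = ℚ.≤-antisym (frac-≤ a b c d (≤-reflexive e)) (frac-≤ c d a b (≤-reflexive (sym e)))

frac-+ : (a b c d : ℕ) .{{_ : NonZero b}} .{{_ : NonZero d}} →
         frac a b +ℚ frac c d ≡ frac (a * d + c * b) (b * d) {{m*n≢0 b d}}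
frac-+ a (suc b) c (suc d) = ℚ.toℚᵘ-injective (begin
  toℚᵘ (frac a (suc b) +ℚ frac c (suc d))
    ≈⟨ ℚ.toℚᵘ-homo-+ (frac a (suc b)) (frac c (suc d)) ⟩
  toℚᵘ (frac a (suc b)) ℚᵘ.+ toℚᵘ (frac c (suc d))
    ≈⟨ ℚᵘ.+-cong (toℚᵘ-frac a b) (toℚᵘ-frac c d) ⟩
  mkℚᵘ (ℤ.+ a ℤ.* ℤ.+ suc d ℤ.+ ℤ.+ c ℤ.* ℤ.+ suc b) (pred (suc b * suc d))
    ≡⟨ cong (λ z → mkℚᵘ z (pred (suc b * suc d))) sum-numerator ⟩
  mkℚᵘ (ℤ.+ (a * suc d + c * suc b)) (pred (suc b * suc d))
    ≈⟨ toℚᵘ-frac⁻¹ _ _ ⟩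
  toℚᵘ (frac (a * suc d + c * suc b) (suc b * suc d)) ∎)
  where
  open ℚᵘ.≃-Reasoning
  sum-numerator : ℤ.+ a ℤ.* ℤ.+ suc d ℤ.+ ℤ.+ c ℤ.* ℤ.+ suc b ≡ ℤ.+ (a * suc d + c * suc b)
  sum-numerator = trans (cong₂ ℤ._+_ (pos-* a (suc d)) (pos-* c (suc b))) (sym (ℤ.pos-+ (a * suc d) (c * suc b)))

frac-* : (a b c d : ℕ) .{{_ : NonZero b}} .{{d≢0 : NonZero d}} →
         frac a b *ℚ frac c d ≡ frac (a * c) (b * d) {{m*n≢0 b d}}
frac-* a (suc b) c (suc d) = ℚ.toℚᵘ-injective (begin
  toℚᵘ (frac a (suc b) *ℚ frac c (suc d))
    ≈⟨ ℚ.toℚᵘ-homo-* (frac a (suc b)) (frac c (suc d)) ⟩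
  toℚᵘ (frac a (suc b)) ℚᵘ.* toℚᵘ (frac c (suc d))
    ≈⟨ ℚᵘ.*-cong (toℚᵘ-frac a b) (toℚᵘ-frac c d) ⟩
  mkℚᵘ (ℤ.+ a ℤ.* ℤ.+ c) (pred (suc b * suc d))
    ≡⟨ cong (λ z → mkℚᵘ z (pred (suc b * suc d))) (pos-* a c) ⟩
  mkℚᵘ (ℤ.+ (a * c)) (pred (suc b * suc d))
    ≈⟨ toℚᵘ-frac⁻¹ _ _ ⟩
  toℚᵘ (frac (a * c) (suc b * suc d)) ∎)
  where open ℚᵘ.≃-Reasoning

frac-+-same : (a c b : ℕ) .{{_ : NonZero b}} → frac a b +ℚ frac c b ≡ frac (a + c) b
frac-+-same a c b = trans (frac-+ a b c b) (frac-≡ (a * b + c * b) (b * b) (a + c) b {{m*n≢0 b b}} (regroup a c b))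
  where
  regroup : ∀ a c b → (a * b + c * b) * b ≡ (a + c) * (b * b)
  regroup = solve-∀

frac-^ : (a b k : ℕ) .{{_ : NonZero b}} → frac a b ^ℚ k ≡ frac (a ^ k) (b ^ k) {{m^n≢0 b k}}
frac-^ a b zero    = refl
frac-^ a b (suc k) = trans (cong (frac a b *ℚ_) (frac-^ a b k)) (frac-* a b (a ^ k) (b ^ k) {{d≢0 = m^n≢0 b k}})

frac-nonneg : (a b : ℕ) .{{_ : NonZero b}} → 0ℚ ≤ℚ frac a b
frac-nonneg a b = subst (_≤ℚ frac a b) (ℚ.0/n≡0 1) (frac-≤ 0 1 a b z≤n)

frac-pos : (a b : ℕ) .{{_ : NonZero b}} → 0ℚ <ℚ frac (suc a) b
frac-pos a b = subst (_<ℚ frac (suc a) b) (ℚ.0/n≡0 1) (frac-< 0 1 (suc a) b (s≤s z≤n))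

positive⇒1/[1+d]≤ : (ε : ℚ) → 0ℚ <ℚ ε → Σ ℕ λ d → frac 1 (suc d) ≤ℚ ε
positive⇒1/[1+d]≤ ε@(mkℚ (ℤ.+ suc p) d _) _ =
  d , subst (frac 1 (suc d) ≤ℚ_) (ℚ.↥p/↧p≡p ε) (frac-≤ 1 (suc d) (suc p) (suc d) (*-monoˡ-≤ (suc d) {1} {suc p} (s≤s z≤n)))
positive⇒1/[1+d]≤ (mkℚ (ℤ.+ zero)  _ _) (ℚ.*<* (ℤ.+<+ ()))
positive⇒1/[1+d]≤ (mkℚ ℤ.-[1+ _ ] _ _) (ℚ.*<* ())

∣-∣-≤ : (x y e : ℚ) → x ≤ℚ y +ℚ e → y ≤ℚ x +ℚ e → ∣ x - y ∣ ≤ℚ e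
∣-∣-≤ x y e x≤y+e y≤x+e with ℚ.∣p∣≡p∨∣p∣≡-p (x - y)
... | inj₁ eq = subst (_≤ℚ e) (sym eq) (ℚ.≤-trans (ℚ.+-monoˡ-≤ (- y) x≤y+e) (ℚ.≤-reflexive (cancel y e)))
  where
  cancel : ∀ y e → (y +ℚ e) - y ≡ e
  cancel = solve 2 (λ y e → (y :+ e) :- y := e) refl
... | inj₂ eq = subst (_≤ℚ e) (sym eq) (ℚ.≤-trans (ℚ.≤-reflexive (flip x y)) (ℚ.≤-trans (ℚ.+-monoˡ-≤ (- x) y≤x+e) (ℚ.≤-reflexive (cancel x e))))
  where
  flip : ∀ x y → - (x - y) ≡ y - x
  flip = solve 2 (λ x y → :- (x :- y) := y :- x) refl
  cancel : ∀ x e → (x +ℚ e) - x ≡ e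
  cancel = solve 2 (λ x e → (x :+ e) :- x := e) refl

frac-∣-∣-≤ : (a b β Z : ℕ) .{{_ : NonZero Z}} → a ≤ b + β → b ≤ a + β → ∣ frac a Z - frac b Z ∣ ≤ℚ frac β Z
frac-∣-∣-≤ a b β Z a≤b+β b≤a+β = ∣-∣-≤ (frac a Z) (frac b Z) (frac β Z)
  (subst (frac a Z ≤ℚ_) (sym (frac-+-same b β Z)) (frac-≤ a Z (b + β) Z (*-monoˡ-≤ Z a≤b+β)))
  (subst (frac b Z ≤ℚ_) (sym (frac-+-same a β Z)) (frac-≤ b Z (a + β) Z (*-monoˡ-≤ Z b≤a+β)))

∣-∣-≤-triangle : (x y p e : ℚ) → ∣ x - p ∣ ≤ℚ e → ∣ y - p ∣ ≤ℚ e → ∣ x - y ∣ ≤ℚ e +ℚ e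
∣-∣-≤-triangle x y p e x≈p y≈p = ℚ.≤-trans (ℚ.≤-reflexive (cong ∣_∣ (split x y p)))
  (ℚ.≤-trans (ℚ.∣p+q∣≤∣p∣+∣q∣ (x - p) (- (y - p)))
    (ℚ.+-mono-≤ x≈p (subst (_≤ℚ e) (sym (ℚ.∣-p∣≡∣p∣ (y - p))) y≈p)))
  where
  split : ∀ x y p → x - y ≡ (x - p) +ℚ - (y - p)
  split = solve 3 (λ x y p → x :- y := (x :- p) :+ :- (y :- p)) refl

≤-+-nonneg : (x y : ℚ) → 0ℚ ≤ℚ y → x ≤ℚ x +ℚ y
≤-+-nonneg x y 0≤y = subst (_≤ℚ x +ℚ y) (ℚ.+-identityʳ x) (ℚ.+-monoʳ-≤ x 0≤y)

≤-−-nonneg : (x y : ℚ) → 0ℚ ≤ℚ y → x - y ≤ℚ x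
≤-−-nonneg x y 0≤y = subst (x - y ≤ℚ_) (ℚ.+-identityʳ x) (ℚ.+-monoʳ-≤ x (ℚ.neg-antimono-≤ 0≤y))

sumBelow : ℕ → (ℕ → ℚ) → ℚ
sumBelow zero    f = 0ℚ
sumBelow (suc k) f = f 0 +ℚ sumBelow k (f ∘ suc)

sumBelow-mono : (k : ℕ) {f g : ℕ → ℚ} → (∀ i → i < k → f i ≤ℚ g i) → sumBelow k f ≤ℚ sumBelow k g
sumBelow-mono zero    h = ℚ.≤-refl
sumBelow-mono (suc k) h = ℚ.+-mono-≤ (h 0 z<s) (sumBelow-mono k (λ i → h (suc i) ∘ s<s))

sumBelow-cong : (k : ℕ) {f g : ℕ → ℚ} → (∀ i → i < k → f i ≡ g i) → sumBelow k f ≡ sumBelow k g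
sumBelow-cong zero    h = refl
sumBelow-cong (suc k) h = cong₂ _+ℚ_ (h 0 z<s) (sumBelow-cong k (λ i → h (suc i) ∘ s<s))

sumBelow-+ : (k : ℕ) (f g : ℕ → ℚ) → sumBelow k (λ i → f i +ℚ g i) ≡ sumBelow k f +ℚ sumBelow k g
sumBelow-+ zero    f g = sym (ℚ.+-identityʳ 0ℚ)
sumBelow-+ (suc k) f g = trans (cong (f 0 +ℚ g 0 +ℚ_) (sumBelow-+ k (f ∘ suc) (g ∘ suc))) (interchange (f 0) (g 0) _ _)
  where
  interchange : ∀ a b c d → (a +ℚ b) +ℚ (c +ℚ d) ≡ (a +ℚ c) +ℚ (b +ℚ d)
  interchange = solve 4 (λ a b c d → (a :+ b) :+ (c :+ d) := (a :+ c) :+ (b :+ d)) refl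

sumBelow-*ˡ : (k : ℕ) (c : ℚ) (f : ℕ → ℚ) → sumBelow k (λ i → c *ℚ f i) ≡ c *ℚ sumBelow k f
sumBelow-*ˡ zero    c f = sym (ℚ.*-zeroʳ c)
sumBelow-*ˡ (suc k) c f = trans (cong (c *ℚ f 0 +ℚ_) (sumBelow-*ˡ k c (f ∘ suc))) (sym (ℚ.*-distribˡ-+ c (f 0) _))

sumBelow-const : (k : ℕ) (c : ℚ) → sumBelow k (λ _ → c) ≡ frac k 1 *ℚ c
sumBelow-const zero    c = trans (sym (ℚ.*-zeroˡ c)) (cong (_*ℚ c) (sym (ℚ.0/n≡0 1)))
sumBelow-const (suc k) c = begin
  c +ℚ sumBelow k (λ _ → c)        ≡⟨ cong (c +ℚ_) (sumBelow-const k c) ⟩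
  c +ℚ frac k 1 *ℚ c               ≡⟨ factor c (frac k 1) ⟩
  (frac 1 1 +ℚ frac k 1) *ℚ c      ≡⟨ cong (_*ℚ c) (frac-+-same 1 k 1) ⟩
  frac (suc k) 1 *ℚ c              ∎
  where
  open ≡-Reasoning
  factor : ∀ c x → c +ℚ x *ℚ c ≡ (1ℚ +ℚ x) *ℚ c
  factor = solve 2 (λ c x → c :+ x :* c := (con 1ℚ :+ x) :* c) refl

sumBelow-last : (k : ℕ) (f : ℕ → ℚ) → sumBelow (suc k) f ≡ sumBelow k f +ℚ f k
sumBelow-last zero    f = trans (ℚ.+-identityʳ (f 0)) (sym (ℚ.+-identityˡ (f 0)))
sumBelow-last (suc k) f = trans (cong (f 0 +ℚ_) (sumBelow-last k (f ∘ suc))) (sym (ℚ.+-assoc (f 0) _ _))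

sumBelow-reverse : (k : ℕ) (f : ℕ → ℚ) → sumBelow k f ≡ sumBelow k (λ i → f (k ∸ suc i))
sumBelow-reverse zero    f = refl
sumBelow-reverse (suc k) f =
  trans (sumBelow-last k f) (trans (ℚ.+-comm (sumBelow k f) (f k)) (cong (f k +ℚ_) (sumBelow-reverse k f)))

-- Conditioning on 0, N - 1 ∈ S

HasEndpoints : (N : ℕ) → Subset N → Bool
HasEndpoints N S = elem S 0 ∧ elem S (N ∸ 1)

Pr : (N : ℕ) → (Subset N → Bool) → ℚ
Pr N X = condProb N X (HasEndpoints N)

Pr-cong : (N : ℕ) {X Y : Subset N → Bool} → (∀ S → X S ≡ Y S) → Pr N X ≡ Pr N Y
Pr-cong N h = cong (λ c → ratio c (countSubsets N (HasEndpoints N)))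
                   (countSubsets-cong N (λ S → cong (_∧ HasEndpoints N S) (h S)))

Missing : {N : ℕ} → ℕ → Subset N → Bool
Missing d S = not (hasDifference S d)

Missing⇒notBoth : {N : ℕ} (d : ℕ) (S : Subset N) → Missing d S ≡ true → ∀ y → holds (notBoth y (y + d)) S ≡ true
Missing⇒notBoth {N} d S missing y with y <? N
... | yes y<N = cong not (anyBelow-false N _ (not-true missing) y<N)
  where
  not-true : ∀ {b} → not b ≡ true → b ≡ false
  not-true {false} _ = refl
... | no  y≮N rewrite elem-≥ S (≮⇒≥ y≮N) = refl

-- These conditions make the pairs {a i, a i + d} pairwise disjoint and disjoint from {0, N - 1}.
record DisjointPairs (N d : ℕ) (a : ℕ → ℕ) (k : ℕ) : Set where
  field
    d≥1     : 1 ≤ d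
    inside  : ∀ {i} → i < k → 1 ≤ a i × a i + d < N ∸ 1
    ordered : ∀ {i j} → i < j → j < k → a i < a j × a i + d ≢ a j

module Conditioned (N : ℕ) (2≤N : 2 ≤ N) where

  N∸1<N : N ∸ 1 < N
  N∸1<N = lemma 2≤N
    where
    lemma : ∀ {N} → 2 ≤ N → N ∸ 1 < N
    lemma (s≤s _) = ≤-refl

  0≢N∸1 : 0 ≢ N ∸ 1
  0≢N∸1 = lemma 2≤N
    where
    lemma : ∀ {N} → 2 ≤ N → 0 ≢ N ∸ 1
    lemma (s≤s (s≤s _)) ()

  ends : List Clause → List Clause
  ends cs = present 0 ∷ present (N ∸ 1) ∷ cs

  Independent-ends : {cs : List Clause} → All (Apart (present 0)) cs → All (Apart (present (N ∸ 1))) cs →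
                     Independent N cs → Independent N (ends cs)
  Independent-ends apart₀ apartₗ ind =
    Independent-∷ (≤-trans (s≤s z≤n) 2≤N) (((0≢N∸1 ∷ []) ∷ []) ∷ apart₀) (Independent-∷ N∸1<N apartₗ ind)

  Z : ℕ
  Z = countSubsets N (HasEndpoints N)

  countSubsets-ends : (cs : List Clause) → Independent N (ends cs) →
                      countSubsets N (holdsAll (ends cs)) * 4 * denominatorAll cs ≡ numeratorAll cs * 2 ^ N
  countSubsets-ends cs ind = trans (regroup (countSubsets N (holdsAll (ends cs))) (denominatorAll cs))
    (trans (countSubsets-holdsAll N (ends cs) ind) (cong (_* 2 ^ N) (trans (*-identityˡ (1 * numeratorAll cs)) (*-identityˡ (numeratorAll cs)))))
    where
    regroup : ∀ x d → x * 4 * d ≡ x * (2 * (2 * d))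
    regroup = solve-∀

  Z*4≡2^N : Z * 4 ≡ 2 ^ N
  Z*4≡2^N = begin
    Z * 4                                    ≡⟨ cong (_* 4) (countSubsets-cong N (λ S → cong (elem S 0 ∧_) (sym (∧-identityʳ _)))) ⟩
    countSubsets N (holdsAll (ends [])) * 4  ≡⟨ sym (*-identityʳ _) ⟩
    countSubsets N (holdsAll (ends [])) * 4 * 1 ≡⟨ countSubsets-ends [] (Independent-ends [] [] ([] , [])) ⟩
    1 * 2 ^ N                                ≡⟨ *-identityˡ _ ⟩
    2 ^ N ∎
    where open ≡-Reasoning

  instance
    Z≢0 : NonZero Z
    Z≢0 = ≢-nonZero λ Z≡0 → ≢-nonZero⁻¹ (2 ^ N) {{m^n≢0 2 N}} (trans (sym Z*4≡2^N) (cong (_* 4) Z≡0))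

  countWith : (Subset N → Bool) → ℕ
  countWith X = countSubsets N (λ S → X S ∧ HasEndpoints N S)

  Pr≡frac : (X : Subset N → Bool) → Pr N X ≡ frac (countWith X) Z
  Pr≡frac X = ratio≡frac (countWith X) Z

  countSubsets-ends-Z : (cs : List Clause) → Independent N (ends cs) →
                        countSubsets N (holdsAll (ends cs)) * denominatorAll cs ≡ numeratorAll cs * Z
  countSubsets-ends-Z cs ind = *-cancelʳ-≡ _ _ 4 (begin
    E * denominatorAll cs * 4         ≡⟨ swap E (denominatorAll cs) ⟩
    E * 4 * denominatorAll cs         ≡⟨ countSubsets-ends cs ind ⟩
    numeratorAll cs * 2 ^ N           ≡⟨ cong (numeratorAll cs *_) (sym Z*4≡2^N) ⟩
    numeratorAll cs * (Z * 4)         ≡⟨ sym (*-assoc (numeratorAll cs) Z 4) ⟩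
    numeratorAll cs * Z * 4           ∎)
    where
    open ≡-Reasoning
    E : ℕ
    E = countSubsets N (holdsAll (ends cs))
    swap : ∀ x d → x * d * 4 ≡ x * 4 * d
    swap = solve-∀

  Pr-≤-clauses : (cs : List Clause) → Independent N (ends cs) → (X : Subset N → Bool) →
                 (∀ S → (X S ∧ HasEndpoints N S) ≡ true → holdsAll cs S ≡ true) →
                 Pr N X ≤ℚ frac (numeratorAll cs) (denominatorAll cs) {{denominatorAll≢0 cs}}
  Pr-≤-clauses cs ind X X⇒cs = begin
    Pr N X                            ≡⟨ Pr≡frac X ⟩
    frac (countWith X) Z              ≤⟨ frac-≤ (countWith X) Z E Z (*-monoˡ-≤ Z (countSubsets-mono N implies)) ⟩
    frac E Z                          ≡⟨ frac-≡ E Z (numeratorAll cs) (denominatorAll cs) {{Z≢0}} {{denominatorAll≢0 cs}} (countSubsets-ends-Z cs ind) ⟩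
    frac (numeratorAll cs) (denominatorAll cs) {{denominatorAll≢0 cs}} ∎
    where
    open ℚ.≤-Reasoning
    E : ℕ
    E = countSubsets N (holdsAll (ends cs))
    implies : ∀ S → (X S ∧ HasEndpoints N S) ≡ true → holdsAll (ends cs) S ≡ true
    implies S h with ∧-conicalʳ (X S) _ h
    ... | ends-hold = cong₂ _∧_ (∧-conicalˡ (elem S 0) _ ends-hold) (cong₂ _∧_ (∧-conicalʳ (elem S 0) _ ends-hold) (X⇒cs S h))

  Pr-≥-clauses : (cs : List Clause) → Independent N (ends cs) → (Y : Subset N → Bool) →
                 (∀ S → holdsAll (ends cs) S ≡ true → Y S ≡ true) →
                 frac (numeratorAll cs) (denominatorAll cs) {{denominatorAll≢0 cs}} ≤ℚ Pr N Y
  Pr-≥-clauses cs ind Y cs⇒Y = begin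
    frac (numeratorAll cs) (denominatorAll cs) {{denominatorAll≢0 cs}}
      ≡⟨ sym (frac-≡ E Z (numeratorAll cs) (denominatorAll cs) {{Z≢0}} {{denominatorAll≢0 cs}} (countSubsets-ends-Z cs ind)) ⟩
    frac E Z
      ≤⟨ frac-≤ E Z (countWith Y) Z (*-monoˡ-≤ Z (countSubsets-mono N implies)) ⟩
    frac (countWith Y) Z
      ≡⟨ sym (Pr≡frac Y) ⟩
    Pr N Y ∎
    where
    open ℚ.≤-Reasoning
    E : ℕ
    E = countSubsets N (holdsAll (ends cs))
    implies : ∀ S → holdsAll (ends cs) S ≡ true → (Y S ∧ HasEndpoints N S) ≡ true
    implies S h = cong₂ _∧_ (cs⇒Y S h)
      (cong₂ _∧_ (∧-conicalˡ (elem S 0) _ h) (∧-conicalˡ (elem S (N ∸ 1)) _ (∧-conicalʳ (elem S 0) _ h)))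

  Pr-∨-≤ : (X Y : Subset N → Bool) → Pr N (λ S → X S ∨ Y S) ≤ℚ Pr N X +ℚ Pr N Y
  Pr-∨-≤ X Y = begin
    Pr N X∨Y                             ≡⟨ Pr≡frac X∨Y ⟩
    frac (countWith X∨Y) Z               ≤⟨ frac-≤ (countWith X∨Y) Z (countWith X + countWith Y) Z
                                              (*-monoˡ-≤ Z (count-subadditive pointwise (allSubsets N))) ⟩
    frac (countWith X + countWith Y) Z   ≡⟨ sym (frac-+-same (countWith X) (countWith Y) Z) ⟩
    frac (countWith X) Z +ℚ frac (countWith Y) Z ≡⟨ sym (cong₂ _+ℚ_ (Pr≡frac X) (Pr≡frac Y)) ⟩
    Pr N X +ℚ Pr N Y ∎
    where
    open ℚ.≤-Reasoning
    X∨Y : Subset N → Bool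
    X∨Y S = X S ∨ Y S
    pointwise : ∀ S → toℕ ((X S ∨ Y S) ∧ HasEndpoints N S) ≤ toℕ (X S ∧ HasEndpoints N S) + toℕ (Y S ∧ HasEndpoints N S)
    pointwise S with X S | Y S | HasEndpoints N S
    ... | true  | true  | true  = s≤s z≤n
    ... | true  | false | true  = s≤s z≤n
    ... | false | true  | true  = s≤s z≤n
    ... | false | false | true  = z≤n
    ... | true  | true  | false = z≤n
    ... | true  | false | false = z≤n
    ... | false | true  | false = z≤n
    ... | false | false | false = z≤n

  Pr-inclusion-exclusion : (X Y : Subset N → Bool) →
                           Pr N (λ S → X S ∨ Y S) +ℚ Pr N (λ S → X S ∧ Y S) ≡ Pr N X +ℚ Pr N Y
  Pr-inclusion-exclusion X Y = begin
    Pr N X∨Y +ℚ Pr N X∧Y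
      ≡⟨ cong₂ _+ℚ_ (Pr≡frac X∨Y) (Pr≡frac X∧Y) ⟩
    frac (countWith X∨Y) Z +ℚ frac (countWith X∧Y) Z
      ≡⟨ frac-+-same (countWith X∨Y) (countWith X∧Y) Z ⟩
    frac (countWith X∨Y + countWith X∧Y) Z
      ≡⟨ cong (λ c → frac c Z) (count-additive pointwise (allSubsets N)) ⟩
    frac (countWith X + countWith Y) Z
      ≡⟨ sym (frac-+-same (countWith X) (countWith Y) Z) ⟩
    frac (countWith X) Z +ℚ frac (countWith Y) Z
      ≡⟨ sym (cong₂ _+ℚ_ (Pr≡frac X) (Pr≡frac Y)) ⟩
    Pr N X +ℚ Pr N Y ∎
    where
    open ≡-Reasoning
    X∨Y X∧Y : Subset N → Bool
    X∨Y S = X S ∨ Y S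
    X∧Y S = X S ∧ Y S
    pointwise : ∀ S → toℕ ((X S ∨ Y S) ∧ HasEndpoints N S) + toℕ ((X S ∧ Y S) ∧ HasEndpoints N S)
                      ≡ toℕ (X S ∧ HasEndpoints N S) + toℕ (Y S ∧ HasEndpoints N S)
    pointwise S with X S | Y S | HasEndpoints N S
    ... | true  | true  | false = refl
    ... | true  | false | false = refl
    ... | false | true  | false = refl
    ... | false | false | false = refl
    ... | true  | true  | true  = refl
    ... | true  | false | true  = refl
    ... | false | true  | true  = refl
    ... | false | false | true  = refl

  Pr-∨ : (X Y : Subset N → Bool) → Pr N (λ S → X S ∨ Y S) ≡ (Pr N X +ℚ Pr N Y) - Pr N (λ S → X S ∧ Y S)
  Pr-∨ X Y = trans (undo (Pr N (λ S → X S ∨ Y S)) (Pr N (λ S → X S ∧ Y S)))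
                   (cong (_- Pr N (λ S → X S ∧ Y S)) (Pr-inclusion-exclusion X Y))
    where
    undo : ∀ x y → x ≡ (x +ℚ y) - y
    undo = solve 2 (λ x y → x := (x :+ y) :- y) refl

  Pr-anyBelow-≤ : (k : ℕ) (X : ℕ → Subset N → Bool) → Pr N (λ S → anyBelow k (λ i → X i S)) ≤ℚ sumBelow k (λ i → Pr N (X i))
  Pr-anyBelow-≤ zero    X = ℚ.≤-reflexive (trans (Pr≡frac (λ _ → false)) (trans (cong (λ c → frac c Z) (countSubsets-const N false)) (ℚ.0/n≡0 Z)))
  Pr-anyBelow-≤ (suc k) X = ℚ.≤-trans (Pr-∨-≤ (X 0) (λ S → anyBelow k (λ i → X (suc i) S)))
                                      (ℚ.+-monoʳ-≤ (Pr N (X 0)) (Pr-anyBelow-≤ k (X ∘ suc)))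

-- Reduction to the outer blocks

take-++ : {A : Set} {a b : ℕ} (u : Vec A a) (v : Vec A b) → take a (u ++ᵥ v) ≡ u
take-++ []      v = refl
take-++ (x ∷ u) v = cong (x ∷_) (take-++ u v)

drop-++ : {A : Set} {a b : ℕ} (u : Vec A a) (v : Vec A b) → drop a (u ++ᵥ v) ≡ v
drop-++ []      v = refl
drop-++ (x ∷ u) v = drop-++ u v

missesDifferenceUpTo : {n : ℕ} → ℕ → Subset n → Bool
missesDifferenceUpTo k S = anyBelow k (λ i → not (hasDifference S (suc i)))

toℕ-∧-≤ : (e φ c bad : Bool) → (bad ≡ false → c ≡ true → e ≡ φ) → toℕ (e ∧ c) ≤ toℕ (φ ∧ c) + toℕ (bad ∧ c)
toℕ-∧-≤ e φ false bad _ rewrite ∧-zeroʳ e = z≤n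
toℕ-∧-≤ e φ true  true _ rewrite ∧-identityʳ e | ∧-identityʳ φ = ≤-trans (toℕ-≤-1 e) (m≤n+m 1 (toℕ φ))
  where
  toℕ-≤-1 : ∀ b → toℕ b ≤ 1
  toℕ-≤-1 false = z≤n
  toℕ-≤-1 true  = ≤-refl
toℕ-∧-≤ e φ true  false h rewrite h refl refl = m≤m+n _ 0

upperDeficiency : (H : ℕ) → Subset (2 * H) → ℕ
upperDeficiency H T = H ∸ diffUpperSize H T

upperProbability : (H K : ℕ) → ℚ
upperProbability H K = Pr (2 * H) (λ T → does (upperDeficiency H T + upperDeficiency H T ≟ K))

hasDeficiency : (K : ℕ) {N : ℕ} → Subset N → Bool
hasDeficiency K {N} S = does ((2 * N ∸ 1) ∸ diffSetSize S ≟ K)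


module Layout (h r : ℕ) where

  H N : ℕ
  H = suc h
  N = H + (r + (H + 0))

  outer : Subset N → Subset (2 * H)
  outer S = take H S ++ᵥ drop r (drop H S)

  outer-++ : (u : Subset H) (v : Subset r) (w : Subset (H + 0)) → outer (u ++ᵥ (v ++ᵥ w)) ≡ u ++ᵥ w
  outer-++ u v w = cong₂ _++ᵥ_ (take-++ u (v ++ᵥ w)) (trans (cong (drop r) (drop-++ u (v ++ᵥ w))) (drop-++ v w))

  by-blocks : {P : Subset N → Set} → ((u : Subset H) (v : Subset r) (w : Subset (H + 0)) → P (u ++ᵥ (v ++ᵥ w))) →
              ∀ S → P S
  by-blocks {P} P-blocks S = subst P blocks (P-blocks (take H S) (take r (drop H S)) (drop r (drop H S)))
    where
    blocks : take H S ++ᵥ (take r (drop H S) ++ᵥ drop r (drop H S)) ≡ S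
    blocks = trans (cong (take H S ++ᵥ_) (take++drop≡id r (drop H S))) (take++drop≡id H S)

  HasEndpoints-outer : ∀ S → HasEndpoints N S ≡ HasEndpoints (2 * H) (outer S)
  HasEndpoints-outer = by-blocks λ u v w → trans (endpoints u v w) (cong (HasEndpoints (2 * H)) (sym (outer-++ u v w)))
    where
    last : ∀ h r → h + (r + (suc h + 0)) ≡ suc h + (r + h)
    last = solve-∀
    last′ : ∀ h → suc h + h ≡ h + (suc h + 0)
    last′ = solve-∀
    endpoints : (u : Subset H) (v : Subset r) (w : Subset (H + 0)) →
                HasEndpoints N (u ++ᵥ (v ++ᵥ w)) ≡ HasEndpoints (2 * H) (u ++ᵥ w)
    endpoints (b ∷ u) v w = cong (b ∧_) (begin
      elem (b ∷ u ++ᵥ (v ++ᵥ w)) (h + (r + (H + 0)))   ≡⟨ cong (elem (b ∷ u ++ᵥ (v ++ᵥ w))) (last h r) ⟩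
      elem (b ∷ u ++ᵥ (v ++ᵥ w)) (H + (r + h))         ≡⟨ elem-++ʳ (b ∷ u) (v ++ᵥ w) (r + h) ⟩
      elem (v ++ᵥ w) (r + h)                           ≡⟨ elem-++ʳ v w h ⟩
      elem w h                                         ≡⟨ sym (elem-++ʳ (b ∷ u) w h) ⟩
      elem (b ∷ u ++ᵥ w) (H + h)                       ≡⟨ cong (elem (b ∷ u ++ᵥ w)) (last′ h) ⟩
      elem (b ∷ u ++ᵥ w) (h + (H + 0))                 ∎)
      where open ≡-Reasoning

  -- A difference of length ≥ H + r can only join the first block to the last one.
  crossDifference : Subset H → Subset (H + 0) → ℕ → Bool
  crossDifference u w i = anyBelow H (λ y → elem u y ∧ elem w (y + i))

  hasDifference-long : (u : Subset H) (v : Subset r) (w : Subset (H + 0)) (i : ℕ) →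
                       hasDifference (u ++ᵥ (v ++ᵥ w)) (H + r + i) ≡ crossDifference u w i
  hasDifference-long u v w i = begin
    anyBelow N (λ y → elem S y ∧ elem S (y + (H + r + i)))
      ≡⟨ anyBelow-truncate _ (m≤m+n H _) (λ y H≤y → trans (cong (elem S y ∧_) (elem-≥ S (beyond y H≤y))) (∧-zeroʳ _)) ⟩
    anyBelow H (λ y → elem S y ∧ elem S (y + (H + r + i)))
      ≡⟨ anyBelow-cong H (λ y y<H → cong₂ _∧_ (elem-++ˡ u (v ++ᵥ w) y<H) (inner y)) ⟩
    crossDifference u w i ∎
    where
    open ≡-Reasoning
    S : Subset N
    S = u ++ᵥ (v ++ᵥ w)
    shift : ∀ y H r i → y + (H + r + i) ≡ H + (r + (y + i))
    shift = solve-∀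
    size : ∀ H r → H + (r + (H + 0)) ≡ H + (H + r)
    size = solve-∀
    beyond : ∀ y → H ≤ y → N ≤ y + (H + r + i)
    beyond y H≤y = subst (_≤ y + (H + r + i)) (sym (size H r)) (+-mono-≤ H≤y (m≤m+n (H + r) i))
    inner : ∀ y → elem S (y + (H + r + i)) ≡ elem w (y + i)
    inner y = trans (cong (elem S) (shift y H r i)) (trans (elem-++ʳ u (v ++ᵥ w) _) (elem-++ʳ v w (y + i)))

  hasDifference-outer-long : (u : Subset H) (w : Subset (H + 0)) (i : ℕ) →
                             hasDifference (u ++ᵥ w) (H + i) ≡ crossDifference u w i
  hasDifference-outer-long u w i = begin
    anyBelow (2 * H) (λ y → elem uw y ∧ elem uw (y + (H + i)))
      ≡⟨ anyBelow-truncate _ (m≤m+n H _) (λ y H≤y → trans (cong (elem uw y ∧_) (elem-≥ uw (beyond y H≤y))) (∧-zeroʳ _)) ⟩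
    anyBelow H (λ y → elem uw y ∧ elem uw (y + (H + i)))
      ≡⟨ anyBelow-cong H (λ y y<H → cong₂ _∧_ (elem-++ˡ u w y<H) (inner y)) ⟩
    crossDifference u w i ∎
    where
    open ≡-Reasoning
    uw : Subset (2 * H)
    uw = u ++ᵥ w
    shift : ∀ y H i → y + (H + i) ≡ H + (y + i)
    shift = solve-∀
    beyond : ∀ y → H ≤ y → 2 * H ≤ y + (H + i)
    beyond y H≤y = +-mono-≤ H≤y (subst (_≤ H + i) (sym (+-identityʳ H)) (m≤m+n H i))
    inner : ∀ y → elem uw (y + (H + i)) ≡ elem w (y + i)
    inner y = trans (cong (elem uw) (shift y H i)) (elem-++ʳ u w (y + i))

  Bad : Subset N → Bool
  Bad = missesDifferenceUpTo (N ∸ suc H)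

  -- Outside Bad, only the H longest differences can be missing, and those are read off the outer blocks.
  missingDifferences-outer : ∀ S → Bad S ≡ false → missingDifferences S ≡ H ∸ diffUpperSize H (outer S)
  missingDifferences-outer = by-blocks missing
    where
    length-split : ∀ h r → h + (r + (suc h + 0)) ≡ (h + r) + suc h
    length-split = solve-∀
    missing : (u : Subset H) (v : Subset r) (w : Subset (H + 0)) → let S = u ++ᵥ (v ++ᵥ w) in
              Bad S ≡ false → missingDifferences S ≡ H ∸ diffUpperSize H (outer S)
    missing u v w good = begin
      countBelow (N ∸ 1) (λ i → not (hasDifference S (suc i)))
        ≡⟨ cong (λ k → countBelow k (λ i → not (hasDifference S (suc i)))) (length-split h r) ⟩
      countBelow ((h + r) + H) (λ i → not (hasDifference S (suc i)))
        ≡⟨ countBelow-+ (h + r) H (λ i → not (hasDifference S (suc i))) ⟩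
      countBelow (h + r) (λ i → not (hasDifference S (suc i))) + countBelow H (λ i → not (hasDifference S (H + r + i)))
        ≡⟨ cong₂ _+_ (countBelow-allFalse (h + r) short) (countBelow-cong H λ i _ → cong not (long i)) ⟩
      countBelow H (λ i → not (hasDifference uw (H + i)))
        ≡⟨ sym (diffUpperSize-deficiency H uw) ⟩
      H ∸ diffUpperSize H uw
        ≡⟨ cong (λ X → H ∸ diffUpperSize H X) (sym (outer-++ u v w)) ⟩
      H ∸ diffUpperSize H (outer S) ∎
      where
      open ≡-Reasoning
      S : Subset N
      S = u ++ᵥ (v ++ᵥ w)
      uw : Subset (2 * H)
      uw = u ++ᵥ w
      short : ∀ i → i < h + r → not (hasDifference S (suc i)) ≡ false
      short i i<h+r = anyBelow-false (N ∸ suc H) _ good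
                        (subst (i <_) (sym (trans (cong (_∸ H) (length-split h r)) (m+n∸n≡m (h + r) H))) i<h+r)
      long : ∀ i → hasDifference S (H + r + i) ≡ hasDifference uw (H + i)
      long i = trans (hasDifference-long u v w i) (sym (hasDifference-outer-long u w i))

  countSubsets-outer : (Φ : Subset (2 * H) → Bool) →
                       countSubsets N (λ S → Φ (outer S) ∧ HasEndpoints N S)
                         ≡ 2 ^ r * countSubsets (2 * H) (λ T → Φ T ∧ HasEndpoints (2 * H) T)
  countSubsets-outer Φ = trans (countSubsets-cong N (λ S → cong (Φ (outer S) ∧_) (HasEndpoints-outer S)))
    (countSubsets-ignoring-middle H r (H + 0) (λ u v w → cong (λ T → Φ T ∧ HasEndpoints (2 * H) T) (outer-++ u v w)))

  module Compare (E : Subset N → Bool) (Φ : Subset (2 * H) → Bool)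
                 (agree : ∀ S → Bad S ≡ false → elem S 0 ≡ true → E S ≡ Φ (outer S)) where

    countE countΦ countBad : ℕ
    countE   = countSubsets N (λ S → E S ∧ HasEndpoints N S)
    countΦ   = countSubsets (2 * H) (λ T → Φ T ∧ HasEndpoints (2 * H) T)
    countBad = countSubsets N (λ S → Bad S ∧ HasEndpoints N S)

    private
      agree′ : ∀ S → Bad S ≡ false → HasEndpoints N S ≡ true → E S ≡ Φ (outer S)
      agree′ S good c = agree S good (∧-conicalˡ _ _ c)

    countE-≤ : countE ≤ 2 ^ r * countΦ + countBad
    countE-≤ = subst (λ x → countE ≤ x + countBad) (countSubsets-outer Φ)
      (count-subadditive (λ S → toℕ-∧-≤ (E S) (Φ (outer S)) (HasEndpoints N S) (Bad S) (agree′ S)) (allSubsets N))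

    countΦ-≤ : 2 ^ r * countΦ ≤ countE + countBad
    countΦ-≤ = subst (_≤ countE + countBad) (countSubsets-outer Φ)
      (count-subadditive (λ S → toℕ-∧-≤ (Φ (outer S)) (E S) (HasEndpoints N S) (Bad S) (λ g c → sym (agree′ S g c))) (allSubsets N))

  deficiency-outer : ∀ S → Bad S ≡ false → elem S 0 ≡ true →
                     (2 * N ∸ 1) ∸ diffSetSize S ≡ upperDeficiency H (outer S) + upperDeficiency H (outer S)
  deficiency-outer S good 0∈S = trans (diffSetSize-deficiency S 0∈S) (cong (λ x → x + x) (missingDifferences-outer S good))

  2≤N : 2 ≤ N
  2≤N = s≤s (≤-trans (≤-trans (s≤s z≤n) (m≤n+m (H + 0) r)) (m≤n+m (r + (H + 0)) h))

  2≤2H : 2 ≤ 2 * H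
  2≤2H = *-monoʳ-≤ 2 (s≤s z≤n)

  Pr-deficiency-≈ : (K : ℕ) → ∣ Pr N (hasDeficiency K) - upperProbability H K ∣ ≤ℚ Pr N Bad
  Pr-deficiency-≈ K = begin
    ∣ Pr N (hasDeficiency K) - upperProbability H K ∣ ≡⟨ cong₂ (λ x y → ∣ x - y ∣) (Pr≡frac (hasDeficiency K)) Pr-Φ≡ ⟩
    ∣ frac countE Z - frac (2 ^ r * countΦ) Z ∣        ≤⟨ frac-∣-∣-≤ countE (2 ^ r * countΦ) countBad Z countE-≤ countΦ-≤ ⟩
    frac countBad Z                                    ≡⟨ sym (Pr≡frac Bad) ⟩
    Pr N Bad                                           ∎
    where
    open ℚ.≤-Reasoning
    open Conditioned N 2≤N using (Z; Z≢0; Pr≡frac)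
    module Outer = Conditioned (2 * H) 2≤2H
    Φ : Subset (2 * H) → Bool
    Φ T = does (upperDeficiency H T + upperDeficiency H T ≟ K)
    agree : ∀ S → Bad S ≡ false → elem S 0 ≡ true → hasDeficiency K S ≡ Φ (outer S)
    agree S good 0∈S = cong (λ x → does (x ≟ K)) (deficiency-outer S good 0∈S)
    open Compare (hasDeficiency K) Φ agree
    Z≡ : Z ≡ 2 ^ r * Outer.Z
    Z≡ = countSubsets-outer (λ _ → true)
    regroup : ∀ c t z → c * (t * z) ≡ t * c * z
    regroup = solve-∀
    Pr-Φ≡ : upperProbability H K ≡ frac (2 ^ r * countΦ) Z
    Pr-Φ≡ = trans (Outer.Pr≡frac Φ) (frac-≡ countΦ Outer.Z (2 ^ r * countΦ) Z {{Outer.Z≢0}} {{Z≢0}}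
              (trans (cong (countΦ *_) Z≡) (regroup countΦ (2 ^ r) Outer.Z)))

-- Missing differences

w : ℕ → ℚ
w k = frac 3 4 ^ℚ k

w≡frac : (k : ℕ) → w k ≡ frac (3 ^ k) (4 ^ k) {{m^n≢0 4 k}}
w≡frac k = frac-^ 3 4 k

w-nonneg : (k : ℕ) → 0ℚ ≤ℚ w k
w-nonneg k = subst (0ℚ ≤ℚ_) (sym (w≡frac k)) (frac-nonneg (3 ^ k) (4 ^ k) {{m^n≢0 4 k}})

3⁵ᵗ*4ᵗ≤4⁵ᵗ : ∀ t → 3 ^ (5 * t) * 4 ^ t ≤ 4 ^ (5 * t)
3⁵ᵗ*4ᵗ≤4⁵ᵗ zero    = ≤-refl
3⁵ᵗ*4ᵗ≤4⁵ᵗ (suc t) = begin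
  3 ^ (5 * suc t) * 4 ^ suc t        ≡⟨ cong (λ e → 3 ^ e * 4 ^ suc t) (*-suc 5 t) ⟩
  3 ^ (5 + 5 * t) * (4 * 4 ^ t)      ≡⟨ cong (_* (4 * 4 ^ t)) (^-distribˡ-+-* 3 5 (5 * t)) ⟩
  (243 * 3 ^ (5 * t)) * (4 * 4 ^ t)  ≡⟨ regroup (3 ^ (5 * t)) (4 ^ t) ⟩
  972 * (3 ^ (5 * t) * 4 ^ t)        ≤⟨ *-mono-≤ (m≤m+n 972 52) (3⁵ᵗ*4ᵗ≤4⁵ᵗ t) ⟩
  1024 * 4 ^ (5 * t)                 ≡⟨ sym (^-distribˡ-+-* 4 5 (5 * t)) ⟩
  4 ^ (5 + 5 * t)                    ≡⟨ cong (4 ^_) (sym (*-suc 5 t)) ⟩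
  4 ^ (5 * suc t)                    ∎
  where
  open ≤-Reasoning
  regroup : ∀ x y → (243 * x) * (4 * y) ≡ 972 * (x * y)
  regroup = solve-∀

-- (3/4)⁵ < 1/4
w-5t-≤ : (t : ℕ) → w (5 * t) ≤ℚ frac 1 (4 ^ t) {{m^n≢0 4 t}}
w-5t-≤ t = subst (_≤ℚ frac 1 (4 ^ t) {{m^n≢0 4 t}}) (sym (w≡frac (5 * t)))
  (frac-≤ (3 ^ (5 * t)) (4 ^ (5 * t)) 1 (4 ^ t) {{m^n≢0 4 (5 * t)}} {{m^n≢0 4 t}} (subst (3 ^ (5 * t) * 4 ^ t ≤_) (sym (*-identityˡ _)) (3⁵ᵗ*4ᵗ≤4⁵ᵗ t)))

sumBelow-w : (s k : ℕ) → sumBelow k (λ i → w (s + i)) +ℚ frac 4 1 *ℚ w (s + k) ≡ frac 4 1 *ℚ w s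
sumBelow-w s zero    = trans (ℚ.+-identityˡ _) (cong (λ i → frac 4 1 *ℚ w i) (+-identityʳ s))
sumBelow-w s (suc k) = begin
  (w (s + 0) +ℚ sumBelow k (λ i → w (s + suc i))) +ℚ frac 4 1 *ℚ w (s + suc k)
    ≡⟨ cong₂ (λ a b → (w a +ℚ b) +ℚ frac 4 1 *ℚ w (s + suc k)) (+-identityʳ s)
             (sumBelow-cong k (λ i _ → cong w (+-suc s i))) ⟩
  (w s +ℚ sumBelow k (λ i → w (suc s + i))) +ℚ frac 4 1 *ℚ w (s + suc k)
    ≡⟨ cong (λ i → (w s +ℚ sumBelow k (λ i → w (suc s + i))) +ℚ frac 4 1 *ℚ w i) (+-suc s k) ⟩
  (w s +ℚ sumBelow k (λ i → w (suc s + i))) +ℚ frac 4 1 *ℚ w (suc s + k)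
    ≡⟨ ℚ.+-assoc (w s) _ _ ⟩
  w s +ℚ (sumBelow k (λ i → w (suc s + i)) +ℚ frac 4 1 *ℚ w (suc s + k))
    ≡⟨ cong (w s +ℚ_) (sumBelow-w (suc s) k) ⟩
  w s +ℚ frac 4 1 *ℚ (frac 3 4 *ℚ w s)
    ≡⟨ geometric (w s) ⟩
  frac 4 1 *ℚ w s ∎
  where
  open ≡-Reasoning
  geometric : ∀ x → x +ℚ frac 4 1 *ℚ (frac 3 4 *ℚ x) ≡ frac 4 1 *ℚ x
  geometric = solve 1 (λ x → x :+ con (frac 4 1) :* (con (frac 3 4) :* x) := con (frac 4 1) :* x) refl

sumBelow-w-≤ : (s k : ℕ) → frac 1 4 *ℚ sumBelow k (λ i → w (s + i)) ≤ℚ w s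
sumBelow-w-≤ s k = ℚ.≤-trans (≤-+-nonneg _ (w (s + k)) (w-nonneg (s + k))) (ℚ.≤-reflexive (begin
  frac 1 4 *ℚ Σw +ℚ w (s + k)                 ≡⟨ pull Σw (w (s + k)) ⟩
  frac 1 4 *ℚ (Σw +ℚ frac 4 1 *ℚ w (s + k))   ≡⟨ cong (frac 1 4 *ℚ_) (sumBelow-w s k) ⟩
  frac 1 4 *ℚ (frac 4 1 *ℚ w s)              ≡⟨ cancel (w s) ⟩
  w s                                        ∎))
  where
  open ≡-Reasoning
  Σw : ℚ
  Σw = sumBelow k (λ i → w (s + i))
  pull : ∀ x y → frac 1 4 *ℚ x +ℚ y ≡ frac 1 4 *ℚ (x +ℚ frac 4 1 *ℚ y)
  pull = solve 2 (λ x y → con (frac 1 4) :* x :+ y := con (frac 1 4) :* (x :+ con (frac 4 1) :* y)) refl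
  cancel : ∀ x → frac 1 4 *ℚ (frac 4 1 *ℚ x) ≡ x
  cancel = solve 1 (λ x → con (frac 1 4) :* (con (frac 4 1) :* x) := x) refl

sumBelow-w-≤4 : (s k : ℕ) → sumBelow k (λ i → w (s + i)) ≤ℚ frac 4 1 *ℚ w s
sumBelow-w-≤4 s k = ℚ.≤-trans (≤-+-nonneg _ _ (four-w-nonneg (s + k))) (ℚ.≤-reflexive (sumBelow-w s k))
  where
  four-w-nonneg : ∀ i → 0ℚ ≤ℚ frac 4 1 *ℚ w i
  four-w-nonneg i = subst (0ℚ ≤ℚ_) (sym (trans (cong (frac 4 1 *ℚ_) (w≡frac i)) (frac-* 4 1 (3 ^ i) (4 ^ i) {{d≢0 = m^n≢0 4 i}})))
                          (frac-nonneg (4 * 3 ^ i) (1 * 4 ^ i) {{m*n≢0 1 (4 ^ i) {{_}} {{m^n≢0 4 i}}}})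

module MissingBounds (N : ℕ) (2≤N : 2 ≤ N) where
  open Conditioned N 2≤N
  open DisjointPairs

  private
    not-true : ∀ {b} → not b ≡ true → b ≡ false
    not-true {false} _ = refl

    not-false : ∀ {b} → b ≡ false → not b ≡ true
    not-false refl = refl

    N∸1≤N : N ∸ 1 ≤ N
    N∸1≤N = m∸n≤m N 1

  Independent-pairs : {d : ℕ} {a : ℕ → ℕ} {k : ℕ} → DisjointPairs N d a k → Independent N (pairs d a k)
  Independent-pairs {d} {a} {k} ok = All.applyUpTo⁺₁ _ k valid , AllPairs.applyUpTo⁺₁ _ k apart
    where
    valid : ∀ {i} → i < k → Valid N (notBoth (a i) (a i + d))
    valid i<k = let (_ , end) = inside ok i<k in
      ≤-trans (s≤s (m≤m+n _ d)) (≤-trans end N∸1≤N) , ≤-trans end N∸1≤N , <⇒≢ (m<m+n _ (d≥1 ok))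
    apart : ∀ {i j} → i < j → j < k → Apart (notBoth (a i) (a i + d)) (notBoth (a j) (a j + d))
    apart {i} {j} i<j j<k = let (aᵢ<aⱼ , aᵢ+d≢aⱼ) = ordered ok i<j j<k in
      (<⇒≢ aᵢ<aⱼ ∷ <⇒≢ (≤-trans aᵢ<aⱼ (m≤m+n _ d)) ∷ []) ∷
      (aᵢ+d≢aⱼ ∷ (λ e → <⇒≢ aᵢ<aⱼ (+-cancelʳ-≡ d _ _ e)) ∷ []) ∷ []

  pairs-apart-0 : {d : ℕ} {a : ℕ → ℕ} {k : ℕ} → DisjointPairs N d a k → All (Apart (present 0)) (pairs d a k)
  pairs-apart-0 {d} {a} {k} ok = All.applyUpTo⁺₁ _ k λ i<k → let (1≤aᵢ , _) = inside ok i<k in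
    ((<⇒≢ 1≤aᵢ ∷ <⇒≢ (≤-trans 1≤aᵢ (m≤m+n _ d)) ∷ []) ∷ [])

  pairs-apart-last : {d : ℕ} {a : ℕ → ℕ} {k : ℕ} → DisjointPairs N d a k → All (Apart (present (N ∸ 1))) (pairs d a k)
  pairs-apart-last {d} {a} {k} ok = All.applyUpTo⁺₁ _ k λ i<k → let (_ , end) = inside ok i<k in
    ((>⇒≢ (≤-<-trans (m≤m+n _ d) end) ∷ >⇒≢ end ∷ []) ∷ [])

  holdsAll-pairs : (d : ℕ) (a : ℕ → ℕ) (k : ℕ) (S : Subset N) → Missing d S ≡ true → holdsAll (pairs d a k) S ≡ true
  holdsAll-pairs d a k S missing = holdsAll-applyUpTo _ k S (λ i _ → Missing⇒notBoth d S missing (a i))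

  Pr-Missing-≤-pairs : {d : ℕ} {a : ℕ → ℕ} {k : ℕ} → DisjointPairs N d a k → Pr N (Missing d) ≤ℚ w k
  Pr-Missing-≤-pairs {d} {a} {k} ok = begin
    Pr N (Missing d)
      ≤⟨ Pr-≤-clauses (pairs d a k) (Independent-ends (pairs-apart-0 ok) (pairs-apart-last ok) (Independent-pairs ok))
                      (Missing d) (λ S h → holdsAll-pairs d a k S (∧-conicalˡ _ _ h)) ⟩
    frac (numeratorAll (pairs d a k)) (denominatorAll (pairs d a k)) {{denominatorAll≢0 (pairs d a k)}}
      ≡⟨ frac-≡ (numeratorAll (pairs d a k)) (denominatorAll (pairs d a k)) (3 ^ k) (4 ^ k) {{denominatorAll≢0 (pairs d a k)}} {{m^n≢0 4 k}}
                (cong₂ _*_ (numeratorAll-pairs d a k) (sym (denominatorAll-pairs d a k))) ⟩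
    frac (3 ^ k) (4 ^ k) {{m^n≢0 4 k}}
      ≡⟨ sym (w≡frac k) ⟩
    w k ∎
    where open ℚ.≤-Reasoning

  Pr-Missing-≤-spaced : (d′ k : ℕ) → suc (k * (2 * suc d′)) < N ∸ 1 → Pr N (Missing (suc d′)) ≤ℚ w k
  Pr-Missing-≤-spaced d′ k fits = Pr-Missing-≤-pairs {a = a} {k = k} record
    { d≥1 = s≤s z≤n
    ; inside = λ {i} i<k → s≤s z≤n , <-trans (s≤s (gap i<k)) fits
    ; ordered = λ i<j _ → s≤s (*-monoˡ-< (2 * d) i<j) , λ e → <⇒≢ (s≤s (gap i<j)) e
    }
    where
    d : ℕ
    d = suc d′
    a : ℕ → ℕ
    a i = suc (i * (2 * d))
    gap : ∀ {i j} → i < j → i * (2 * d) + d < j * (2 * d)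
    gap {i} {j} i<j = <-≤-trans (+-monoʳ-< (i * (2 * d)) (m<m+n d (s≤s z≤n)))
      (≤-trans (≤-reflexive (+-comm (i * (2 * d)) (2 * d))) (*-monoˡ-≤ (2 * d) i<j))

  Pr-Missing-≤-near : (k d j : ℕ) → N ≡ suc (j + d) → k < d → k < j → Pr N (Missing d) ≤ℚ w k
  Pr-Missing-≤-near k d j N≡ k<d k<j = Pr-Missing-≤-pairs {a = suc} {k = k} record
    { d≥1 = ≤-trans (s≤s z≤n) k<d
    ; inside = λ {i} i<k → s≤s z≤n , subst (suc i + d <_) (sym (cong (_∸ 1) N≡)) (+-monoˡ-< d (≤-<-trans i<k k<j))
    ; ordered = λ {i} i<i′ i′<k → s<s i<i′ , λ e → <⇒≢ (<-≤-trans (≤-<-trans i′<k k<d) (m≤n+m d (suc i))) (sym e)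
    }

  absent-partnerʳ : {p q : ℕ} (S : Subset N) → holds (notBoth p q) S ≡ true → elem S p ≡ true → holds (absent q) S ≡ true
  absent-partnerʳ S h p∈S rewrite p∈S = h

  absent-partnerˡ : {p q : ℕ} (S : Subset N) → holds (notBoth p q) S ≡ true → elem S q ≡ true → holds (absent p) S ≡ true
  absent-partnerˡ {p} S h q∈S rewrite q∈S | ∧-identityʳ (elem S p) = h

  -- c = N - 1 - d is the co-distance of d.
  module FarClauses (j d : ℕ) (N≡ : N ≡ suc (suc j + d)) (c<d : suc j < d) where

    c : ℕ
    c = suc j

    clauses : List Clause
    clauses = absent d ∷ absent c ∷ pairs d suc j

    1≤d : 1 ≤ d
    1≤d = ≤-trans (s≤s z≤n) c<d

    N∸1≡ : N ∸ 1 ≡ c + d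
    N∸1≡ = cong (_∸ 1) N≡

    pairs-ok : DisjointPairs N d suc j
    pairs-ok = record
      { d≥1 = 1≤d
      ; inside = λ {i} i<j → s≤s z≤n , subst (suc i + d <_) (sym N∸1≡) (+-monoˡ-< d (s<s i<j))
      ; ordered = λ {i} i<i′ i′<j → s<s i<i′ , λ e → <⇒≢ (<-≤-trans (<-trans (s<s i′<j) c<d) (m≤n+m d (suc i))) (sym e)
      }

    independent : Independent N (ends clauses)
    independent = Independent-ends
      (((<⇒≢ 1≤d ∷ []) ∷ []) ∷ ((<⇒≢ z<s ∷ []) ∷ []) ∷ pairs-apart-0 pairs-ok)
      (((≢-sym d≢N∸1 ∷ []) ∷ []) ∷ ((≢-sym c≢N∸1 ∷ []) ∷ []) ∷ pairs-apart-last pairs-ok)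
      (Independent-∷ d<N (((>⇒≢ c<d ∷ []) ∷ []) ∷
                          All.applyUpTo⁺₁ _ j (λ i<j → (>⇒≢ (<-trans (s<s i<j) c<d) ∷ <⇒≢ (m<n+m d z<s) ∷ []) ∷ []))
        (Independent-∷ c<N (All.applyUpTo⁺₁ _ j (λ i<j → (>⇒≢ (s<s i<j) ∷ <⇒≢ (<-≤-trans c<d (m≤n+m d _)) ∷ []) ∷ []))
          (Independent-pairs pairs-ok)))
      where
      d<N : d < N
      d<N = subst (d <_) (sym N≡) (s≤s (m≤n+m d c))
      c<N : c < N
      c<N = subst (c <_) (sym N≡) (s≤s (m≤m+n c d))
      d≢N∸1 : d ≢ N ∸ 1
      d≢N∸1 e = <⇒≢ (subst (d <_) (sym N∸1≡) (m<n+m d z<s)) e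
      c≢N∸1 : c ≢ N ∸ 1
      c≢N∸1 e = <⇒≢ (subst (c <_) (sym N∸1≡) (m<m+n c 1≤d)) e

    -- 0 and N - 1 = c + d lie in S, so their partners d and c must be absent.
    clauses-hold : ∀ S → (Missing d S ∧ HasEndpoints N S) ≡ true → holdsAll clauses S ≡ true
    clauses-hold S h = cong₂ _∧_
      (absent-partnerʳ S (Missing⇒notBoth d S missing 0) (∧-conicalˡ _ _ endpoints))
      (cong₂ _∧_ (absent-partnerˡ S (Missing⇒notBoth d S missing c) (subst (λ x → elem S x ≡ true) N∸1≡ (∧-conicalʳ (elem S 0) _ endpoints)))
                 (holdsAll-pairs d suc j S missing))
      where
      missing : Missing d S ≡ true
      missing = ∧-conicalˡ (Missing d S) _ h
      endpoints : HasEndpoints N S ≡ true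
      endpoints = ∧-conicalʳ (Missing d S) _ h

    clauses-value : numeratorAll clauses * (4 * 4 ^ j) ≡ (1 * 3 ^ j) * denominatorAll clauses
    clauses-value rewrite numeratorAll-pairs d suc j | denominatorAll-pairs d suc j = arith (3 ^ j) (4 ^ j)
      where
      arith : ∀ x y → 1 * (1 * x) * (4 * y) ≡ (1 * x) * (2 * (2 * y))
      arith = solve-∀

  -- For d > N - 1 - d every pair {x, x + d} is one of the listed clauses, so the bound is exact.
  Pr-Missing-≤-far : (j d : ℕ) → N ≡ suc (suc j + d) → suc j < d → Pr N (Missing d) ≤ℚ frac 1 4 *ℚ w j
  Pr-Missing-≤-far j d N≡ c<d = begin
    Pr N (Missing d)
      ≤⟨ Pr-≤-clauses clauses independent (Missing d) clauses-hold ⟩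
    frac (numeratorAll clauses) (denominatorAll clauses) {{denominatorAll≢0 clauses}}
      ≡⟨ frac-≡ (numeratorAll clauses) (denominatorAll clauses) (1 * 3 ^ j) (4 * 4 ^ j)
                {{denominatorAll≢0 clauses}} {{m*n≢0 4 (4 ^ j) {{_}} {{m^n≢0 4 j}}}} clauses-value ⟩
    frac (1 * 3 ^ j) (4 * 4 ^ j) {{m*n≢0 4 (4 ^ j) {{_}} {{m^n≢0 4 j}}}}
      ≡⟨ sym (trans (cong (frac 1 4 *ℚ_) (w≡frac j)) (frac-* 1 4 (3 ^ j) (4 ^ j) {{d≢0 = m^n≢0 4 j}})) ⟩
    frac 1 4 *ℚ w j ∎
    where
    open ℚ.≤-Reasoning
    open FarClauses j d N≡ c<d

  absents : (ℕ → ℕ) → ℕ → List Clause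
  absents a k = applyUpTo (λ i → absent (a i)) k

  numeratorAll-absents : (a : ℕ → ℕ) (k : ℕ) → numeratorAll (absents a k) ≡ 1
  numeratorAll-absents a zero    = refl
  numeratorAll-absents a (suc k) = trans (+-identityʳ _) (numeratorAll-absents (a ∘ suc) k)

  denominatorAll-absents : (a : ℕ → ℕ) (k : ℕ) → denominatorAll (absents a k) ≡ 2 ^ k
  denominatorAll-absents a zero    = refl
  denominatorAll-absents a (suc k) = cong (2 *_) (denominatorAll-absents (a ∘ suc) k)

  -- With 1, …, m + 1 and e all absent, the only candidate pair {0, e} fails, and every
  -- other pair {y, y + e} has y > m + 1, hence y + e ≥ N.
  Missing-beyond-gap : (m e : ℕ) → N ≤ suc (suc m) + e → (S : Subset N) →
                       (∀ i → i < suc m → elem S (suc i) ≡ false) → elem S e ≡ false → Missing e S ≡ true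
  Missing-beyond-gap m e N≤ S gap e∉S = not-false (anyBelow-allFalse N pair-absent)
    where
    pair-absent : ∀ y → y < N → (elem S y ∧ elem S (y + e)) ≡ false
    pair-absent zero    _ rewrite e∉S = ∧-zeroʳ (elem S 0)
    pair-absent (suc y) _ with suc y ≤? suc m
    ... | yes y≤m rewrite gap y y≤m = refl
    ... | no  y>m rewrite elem-≥ S (≤-trans N≤ (+-monoˡ-≤ e (≰⇒> y>m))) = ∧-zeroʳ (elem S (suc y))

  module LowClauses (m d : ℕ) (1≤m : 1 ≤ m) (N≡ : N ≡ suc (suc (m + d))) (m+2≤d : suc (suc m) ≤ d) where

    clauses : List Clause
    clauses = absent (suc d) ∷ absent d ∷ absents suc (suc m)

    independent : Independent N (ends clauses)
    independent = Independent-ends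
      (((0≢suc ∷ []) ∷ []) ∷ ((0≢d ∷ []) ∷ []) ∷ All.applyUpTo⁺₁ (λ i → absent (suc i)) (suc m) (λ _ → (0≢suc ∷ []) ∷ []))
      (((last (s<s d<m+d) ∷ []) ∷ []) ∷ ((last (<-trans d<m+d (n<1+n _)) ∷ []) ∷ []) ∷
        All.applyUpTo⁺₁ (λ i → absent (suc i)) (suc m) (λ i<m+1 → (last (<-trans (m+1<d i<m+1) (<-trans d<m+d (n<1+n _))) ∷ []) ∷ []))
      (Independent-∷ d+1<N (((>⇒≢ (n<1+n d) ∷ []) ∷ []) ∷
                            All.applyUpTo⁺₁ (λ i → absent (suc i)) (suc m) (λ i<m+1 → (>⇒≢ (<-trans (m+1<d i<m+1) (n<1+n d)) ∷ []) ∷ []))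
        (Independent-∷ d<N (All.applyUpTo⁺₁ (λ i → absent (suc i)) (suc m) (λ i<m+1 → (>⇒≢ (m+1<d i<m+1) ∷ []) ∷ []))
          (All.applyUpTo⁺₁ (λ i → absent (suc i)) (suc m) (λ i<m+1 → <-trans (m+1<d i<m+1) d<N) ,
           AllPairs.applyUpTo⁺₁ (λ i → absent (suc i)) (suc m) (λ i<j _ → (<⇒≢ (s<s i<j) ∷ []) ∷ []))))
      where
      0≢suc : ∀ {x} → 0 ≢ suc x
      0≢suc ()
      0≢d : 0 ≢ d
      0≢d = <⇒≢ (≤-trans (s≤s z≤n) m+2≤d)
      m+1<d : ∀ {i} → i < suc m → suc i < d
      m+1<d i≤m = <-≤-trans (s<s i≤m) m+2≤d
      d<m+d : d < m + d
      d<m+d = +-monoˡ-≤ d 1≤m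
      d<N : d < N
      d<N = subst (d <_) (sym N≡) (<-trans d<m+d (<-trans (n<1+n _) (n<1+n _)))
      d+1<N : suc d < N
      d+1<N = subst (suc d <_) (sym N≡) (s<s (<-trans d<m+d (n<1+n _)))
      last : ∀ {x} → x < suc (m + d) → N ∸ 1 ≢ x
      last x<N∸1 e = <⇒≢ x<N∸1 (trans (sym e) (cong (_∸ 1) N≡))

    clauses-imply : ∀ S → holdsAll (ends clauses) S ≡ true → (Missing d S ∧ Missing (suc d) S) ≡ true
    clauses-imply S h = cong₂ _∧_ (Missing-beyond-gap m d (≤-reflexive N≡) S gap (not-true d∉S))
                                  (Missing-beyond-gap m (suc d) N≤ S gap (not-true d+1∉S))
      where
      N≤ : N ≤ suc (suc m) + suc d
      N≤ = ≤-trans (≤-reflexive N≡) (s≤s (s≤s (+-monoʳ-≤ m (n≤1+n d))))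
      rest : holdsAll clauses S ≡ true
      rest = ∧-conicalʳ (elem S (N ∸ 1)) _ (∧-conicalʳ (elem S 0) _ h)
      rest′ : holdsAll (absent d ∷ absents suc (suc m)) S ≡ true
      rest′ = ∧-conicalʳ (not (elem S (suc d))) _ rest
      d+1∉S : not (elem S (suc d)) ≡ true
      d+1∉S = ∧-conicalˡ (not (elem S (suc d))) _ rest
      d∉S : not (elem S d) ≡ true
      d∉S = ∧-conicalˡ (not (elem S d)) _ rest′
      gap : ∀ i → i < suc m → elem S (suc i) ≡ false
      gap i i<m+1 = not-true (holdsAll-applyUpTo⁻ (λ i → absent (suc i)) (suc m) S (∧-conicalʳ (not (elem S d)) _ rest′) i i<m+1)

    clauses-value : 1 * denominatorAll clauses ≡ numeratorAll clauses * 2 ^ (3 + m)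
    clauses-value rewrite numeratorAll-absents suc (suc m) | denominatorAll-absents suc (suc m) = arith (2 ^ m)
      where
      arith : ∀ x → 1 * (2 * (2 * (2 * x))) ≡ 1 * (1 * 1) * (2 * (2 * (2 * x)))
      arith = solve-∀

  Pr-Missing-both-≥ : (m d : ℕ) → 1 ≤ m → N ≡ suc (suc (m + d)) → suc (suc m) ≤ d →
                      frac 1 (2 ^ (3 + m)) {{m^n≢0 2 (3 + m)}} ≤ℚ Pr N (λ S → Missing d S ∧ Missing (suc d) S)
  Pr-Missing-both-≥ m d 1≤m N≡ m+2≤d = begin
    frac 1 (2 ^ (3 + m)) {{m^n≢0 2 (3 + m)}}
      ≡⟨ frac-≡ 1 (2 ^ (3 + m)) (numeratorAll clauses) (denominatorAll clauses)
                {{m^n≢0 2 (3 + m)}} {{denominatorAll≢0 clauses}} clauses-value ⟩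
    frac (numeratorAll clauses) (denominatorAll clauses) {{denominatorAll≢0 clauses}}
      ≤⟨ Pr-≥-clauses clauses independent _ clauses-imply ⟩
    Pr N (λ S → Missing d S ∧ Missing (suc d) S) ∎
    where
    open ℚ.≤-Reasoning
    open LowClauses m d 1≤m N≡ m+2≤d

-- The bad event

n<2^n : ∀ n → n < 2 ^ n
n<2^n zero    = s≤s z≤n
n<2^n (suc n) = ≤-trans (≤-reflexive (sym (+-comm (suc n) 1))) (+-mono-≤ (n<2^n n) (≤-trans (m^n>0 2 n) (m≤m+n (2 ^ n) 0)))

2^≤4^ : ∀ n → 2 ^ n ≤ 4 ^ n
2^≤4^ n = ^-monoˡ-≤ n (m≤m+n 2 2)

-- The missing difference d ≤ N - 1 - m is short (d ≤ L₀), middle (d and N - 1 - d both > L₀),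
-- long (co-distance N - 1 - d > m + 1) or one of the two longest; the overlap of the last two
-- events gives the slack δ.
module BadBound (m₀ : ℕ) where

  m a L₀ L P N₀ : ℕ
  m  = suc m₀
  a  = 4 * m + 39
  L₀ = suc m + a
  L  = suc L₀
  P  = 5 * (L + m + 5)
  N₀ = P * (2 * L) + 2 * L + 3

  instance
    2^[5+m]≢0 : NonZero (2 ^ (5 + m))
    2^[5+m]≢0 = m^n≢0 2 (5 + m)

  δ : ℚ
  δ = frac 1 (2 ^ (5 + m))

  δ-pos : 0ℚ <ℚ δ
  δ-pos = frac-pos 0 (2 ^ (5 + m))

  2≤N₀ : 2 ≤ N₀
  2≤N₀ = ≤-trans (n≤1+n 2) (m≤n+m 3 (P * (2 * L) + 2 * L))

  L+L≤N₀ : L + L ≤ N₀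
  L+L≤N₀ = ≤-trans (≤-reflexive (cong (L +_) (sym (+-identityʳ L))))
             (≤-trans (m≤n+m (2 * L) (P * (2 * L))) (m≤m+n (P * (2 * L) + 2 * L) 3))

  short-count : L₀ * 3 ^ P * 2 ^ (5 + m) ≤ 1 * (1 * 4 ^ P)
  short-count = begin
    L₀ * 3 ^ P * 2 ^ (5 + m)     ≡⟨ regroup L₀ (3 ^ P) (2 ^ (5 + m)) ⟩
    3 ^ P * (L₀ * 2 ^ (5 + m))   ≤⟨ *-monoʳ-≤ (3 ^ P) L₀*2^≤4^t ⟩
    3 ^ P * 4 ^ t                ≤⟨ 3⁵ᵗ*4ᵗ≤4⁵ᵗ t ⟩
    4 ^ P                        ≡⟨ sym (trans (*-identityˡ _) (*-identityˡ _)) ⟩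
    1 * (1 * 4 ^ P)              ∎
    where
    open ≤-Reasoning
    t : ℕ
    t = L + m + 5
    L₀≤4^L : L₀ ≤ 4 ^ L
    L₀≤4^L = ≤-trans (<⇒≤ (n<2^n L₀)) (≤-trans (2^≤4^ L₀) (^-monoʳ-≤ 4 (n≤1+n L₀)))
    exponent : ∀ L m → L + (5 + m) ≡ L + m + 5
    exponent = solve-∀
    L₀*2^≤4^t : L₀ * 2 ^ (5 + m) ≤ 4 ^ t
    L₀*2^≤4^t = ≤-trans (*-mono-≤ L₀≤4^L (2^≤4^ (5 + m)))
      (≤-reflexive (trans (sym (^-distribˡ-+-* 4 L (5 + m))) (cong (4 ^_) (exponent L m))))
    regroup : ∀ x y z → x * y * z ≡ y * (x * z)
    regroup = solve-∀

  short-≤ : frac L₀ 1 *ℚ w P ≤ℚ δ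
  short-≤ = begin
    frac L₀ 1 *ℚ w P                                ≡⟨ cong (frac L₀ 1 *ℚ_) (w≡frac P) ⟩
    frac L₀ 1 *ℚ frac (3 ^ P) (4 ^ P) {{m^n≢0 4 P}} ≡⟨ frac-* L₀ 1 (3 ^ P) (4 ^ P) {{d≢0 = m^n≢0 4 P}} ⟩
    frac (L₀ * 3 ^ P) (1 * 4 ^ P) {{m*n≢0 1 (4 ^ P) {{_}} {{m^n≢0 4 P}}}}
      ≤⟨ frac-≤ (L₀ * 3 ^ P) (1 * 4 ^ P) 1 (2 ^ (5 + m)) {{m*n≢0 1 (4 ^ P) {{_}} {{m^n≢0 4 P}}}} short-count ⟩
    δ ∎
    where open ℚ.≤-Reasoning

  middle-count : (4 * 3 ^ L₀ + 4 * 3 ^ L₀) * 2 ^ (5 + m) ≤ 1 * (1 * 4 ^ L₀)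
  middle-count = begin
    (4 * 3 ^ L₀ + 4 * 3 ^ L₀) * 2 ^ (5 + m)   ≡⟨ regroup (3 ^ L₀) (2 ^ m) ⟩
    3 ^ L₀ * 2 ^ (8 + m)                      ≤⟨ *-monoʳ-≤ (3 ^ L₀) (2^≤4^ (8 + m)) ⟩
    3 ^ L₀ * 4 ^ (8 + m)                      ≡⟨ cong (λ e → 3 ^ e * 4 ^ (8 + m)) L₀≡ ⟩
    3 ^ (5 * (8 + m)) * 4 ^ (8 + m)           ≤⟨ 3⁵ᵗ*4ᵗ≤4⁵ᵗ (8 + m) ⟩
    4 ^ (5 * (8 + m))                         ≡⟨ cong (4 ^_) (sym L₀≡) ⟩
    4 ^ L₀                                    ≡⟨ sym (trans (*-identityˡ _) (*-identityˡ _)) ⟩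
    1 * (1 * 4 ^ L₀)                          ∎
    where
    open ≤-Reasoning
    regroup : ∀ x y → (4 * x + 4 * x) * (2 * (2 * (2 * (2 * (2 * y)))))
                      ≡ x * (2 * (2 * (2 * (2 * (2 * (2 * (2 * (2 * y))))))))
    regroup = solve-∀
    L₀≡ : L₀ ≡ 5 * (8 + m)
    L₀≡ = arith m
      where
      arith : ∀ m → suc m + (4 * m + 39) ≡ 5 * (8 + m)
      arith = solve-∀

  middle-≤ : frac 4 1 *ℚ w L₀ +ℚ frac 4 1 *ℚ w L₀ ≤ℚ δ
  middle-≤ = begin
    frac 4 1 *ℚ w L₀ +ℚ frac 4 1 *ℚ w L₀       ≡⟨ cong (λ x → x +ℚ x) four-w ⟩
    frac (4 * 3 ^ L₀) (1 * 4 ^ L₀) {{nz}} +ℚ frac (4 * 3 ^ L₀) (1 * 4 ^ L₀) {{nz}}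
                                                ≡⟨ frac-+-same (4 * 3 ^ L₀) (4 * 3 ^ L₀) (1 * 4 ^ L₀) {{nz}} ⟩
    frac (4 * 3 ^ L₀ + 4 * 3 ^ L₀) (1 * 4 ^ L₀) {{nz}}
                                                ≤⟨ frac-≤ (4 * 3 ^ L₀ + 4 * 3 ^ L₀) (1 * 4 ^ L₀) 1 (2 ^ (5 + m)) {{nz}} middle-count ⟩
    δ ∎
    where
    open ℚ.≤-Reasoning
    nz : NonZero (1 * 4 ^ L₀)
    nz = m*n≢0 1 (4 ^ L₀) {{_}} {{m^n≢0 4 L₀}}
    four-w : frac 4 1 *ℚ w L₀ ≡ frac (4 * 3 ^ L₀) (1 * 4 ^ L₀) {{nz}}
    four-w = trans (cong (frac 4 1 *ℚ_) (w≡frac L₀)) (frac-* 4 1 (3 ^ L₀) (4 ^ L₀) {{d≢0 = m^n≢0 4 L₀}})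

  overlap≡4δ : frac 1 (2 ^ (3 + m)) {{m^n≢0 2 (3 + m)}} ≡ frac 4 1 *ℚ δ
  overlap≡4δ = sym (trans (frac-* 4 1 1 (2 ^ (5 + m)))
    (frac-≡ (4 * 1) (1 * 2 ^ (5 + m)) 1 (2 ^ (3 + m)) {{m*n≢0 1 (2 ^ (5 + m))}} {{m^n≢0 2 (3 + m)}} (arith (2 ^ m))))
    where
    arith : ∀ y → 4 * 1 * (2 * (2 * (2 * y))) ≡ 1 * (1 * (2 * (2 * (2 * (2 * (2 * y))))))
    arith = solve-∀

  module AtLength (N : ℕ) (N₀≤N : N₀ ≤ N) where

    2≤N : 2 ≤ N
    2≤N = ≤-trans 2≤N₀ N₀≤N

    open Conditioned N 2≤N
    open MissingBounds N 2≤N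

    M : ℕ
    M = N ∸ (L + L)

    N≡ : N ≡ L + (L + M)
    N≡ = trans (sym (m+[n∸m]≡n (≤-trans L+L≤N₀ N₀≤N))) (+-assoc L L M)

    Pr-short : Pr N (λ S → anyBelow L₀ (λ i → Missing (suc i) S)) ≤ℚ δ
    Pr-short = begin
      Pr N (λ S → anyBelow L₀ (λ i → Missing (suc i) S))  ≤⟨ Pr-anyBelow-≤ L₀ (λ i → Missing (suc i)) ⟩
      sumBelow L₀ (λ i → Pr N (Missing (suc i)))          ≤⟨ sumBelow-mono L₀ (λ i i<L₀ → Pr-Missing-≤-spaced i P (fits i<L₀)) ⟩
      sumBelow L₀ (λ _ → w P)                             ≡⟨ sumBelow-const L₀ (w P) ⟩
      frac L₀ 1 *ℚ w P                                    ≤⟨ short-≤ ⟩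
      δ                                                   ∎
      where
      open ℚ.≤-Reasoning
      3+X≤N₀ : 3 + P * (2 * L) ≤ N₀
      3+X≤N₀ = ≤-trans (m≤m+n (3 + P * (2 * L)) (2 * L)) (≤-reflexive (arith (P * (2 * L)) (2 * L)))
        where
        arith : ∀ x y → 3 + x + y ≡ x + y + 3
        arith = solve-∀
      fits : ∀ {i} → i < L₀ → suc (P * (2 * suc i)) < N ∸ 1
      fits i<L₀ = ≤-trans (s≤s (s≤s (*-monoʳ-≤ P (*-monoʳ-≤ 2 (≤-trans i<L₀ (n≤1+n L₀))))))
                          (∸-monoˡ-≤ 1 (≤-trans 3+X≤N₀ N₀≤N))

    Pr-middle-one : ∀ {i} → i < M → Pr N (Missing (suc (L₀ + i))) ≤ℚ w (L₀ + i) +ℚ w (L₀ + (M ∸ suc i))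
    Pr-middle-one {i} i<M = by-cases (i ≤? r)
      where
      r d c : ℕ
      r = M ∸ suc i
      d = suc (L₀ + i)
      c = suc (L₀ + r)
      arith : ∀ ℓ i r → suc ℓ + (suc ℓ + suc (i + r)) ≡ suc (suc (ℓ + r) + suc (ℓ + i))
      arith = solve-∀
      N≡c+d : N ≡ suc (c + d)
      N≡c+d = trans N≡ (trans (cong (λ z → L + (L + z)) (sym (m+[n∸m]≡n i<M))) (arith L₀ i r))
      by-cases : Dec (i ≤ r) → Pr N (Missing d) ≤ℚ w (L₀ + i) +ℚ w (L₀ + r)
      by-cases (yes i≤r) = ℚ.≤-trans (Pr-Missing-≤-near (L₀ + i) d c N≡c+d ≤-refl (s≤s (+-monoʳ-≤ L₀ i≤r)))
                                  (≤-+-nonneg _ _ (w-nonneg (L₀ + r)))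
      by-cases (no i≰r)  = ℚ.≤-trans (Pr-Missing-≤-near (L₀ + r) d c N≡c+d (s≤s (+-monoʳ-≤ L₀ (<⇒≤ (≰⇒> i≰r)))) ≤-refl)
                                  (subst (w (L₀ + r) ≤ℚ_) (ℚ.+-comm (w (L₀ + r)) (w (L₀ + i))) (≤-+-nonneg _ _ (w-nonneg (L₀ + i))))

    Pr-middle : Pr N (λ S → anyBelow M (λ i → Missing (suc (L₀ + i)) S)) ≤ℚ δ
    Pr-middle = begin
      Pr N (λ S → anyBelow M (λ i → Missing (suc (L₀ + i)) S))
        ≤⟨ Pr-anyBelow-≤ M (λ i → Missing (suc (L₀ + i))) ⟩
      sumBelow M (λ i → Pr N (Missing (suc (L₀ + i))))
        ≤⟨ sumBelow-mono M (λ i → Pr-middle-one) ⟩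
      sumBelow M (λ i → w (L₀ + i) +ℚ w (L₀ + (M ∸ suc i)))
        ≡⟨ sumBelow-+ M (λ i → w (L₀ + i)) (λ i → w (L₀ + (M ∸ suc i))) ⟩
      Σw +ℚ sumBelow M (λ i → w (L₀ + (M ∸ suc i)))
        ≡⟨ cong (Σw +ℚ_) (sym (sumBelow-reverse M (λ i → w (L₀ + i)))) ⟩
      Σw +ℚ Σw
        ≤⟨ ℚ.+-mono-≤ (sumBelow-w-≤4 L₀ M) (sumBelow-w-≤4 L₀ M) ⟩
      frac 4 1 *ℚ w L₀ +ℚ frac 4 1 *ℚ w L₀
        ≤⟨ middle-≤ ⟩
      δ ∎
      where
      open ℚ.≤-Reasoning
      Σw : ℚ
      Σw = sumBelow M (λ i → w (L₀ + i))

    Pr-long-one : ∀ {i} → i < a → Pr N (Missing (suc (L₀ + (M + i)))) ≤ℚ frac 1 4 *ℚ w (suc m + (a ∸ suc i))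
    Pr-long-one {i} i<a = Pr-Missing-≤-far (suc m + r) (suc (L₀ + (M + i))) N≡j+d (s≤s (<-≤-trans r<L₀ (m≤m+n L₀ (M + i))))
      where
      r : ℕ
      r = a ∸ suc i
      a≡ : a ≡ suc (i + r)
      a≡ = sym (m+[n∸m]≡n i<a)
      L₀≡ : L₀ ≡ suc m + suc (i + r)
      L₀≡ = cong (suc m +_) a≡
      arith : ∀ ℓ m i r M → suc ℓ + (suc (suc m + suc (i + r)) + M) ≡ suc (suc (suc m + r) + suc (ℓ + (M + i)))
      arith = solve-∀
      N≡j+d : N ≡ suc (suc (suc m + r) + suc (L₀ + (M + i)))
      N≡j+d = trans N≡ (trans (cong (λ ℓ → L + (suc ℓ + M)) L₀≡) (arith L₀ m i r M))
      r<L₀ : suc m + r < L₀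
      r<L₀ = subst (suc m + r <_) (sym L₀≡) (+-monoʳ-< (suc m) (s≤s (m≤n+m r i)))

    Pr-long : Pr N (λ S → anyBelow a (λ i → Missing (suc (L₀ + (M + i))) S)) ≤ℚ w (suc m)
    Pr-long = begin
      Pr N (λ S → anyBelow a (λ i → Missing (suc (L₀ + (M + i))) S))
        ≤⟨ Pr-anyBelow-≤ a (λ i → Missing (suc (L₀ + (M + i)))) ⟩
      sumBelow a (λ i → Pr N (Missing (suc (L₀ + (M + i)))))
        ≤⟨ sumBelow-mono a (λ i → Pr-long-one) ⟩
      sumBelow a (λ i → frac 1 4 *ℚ w (suc m + (a ∸ suc i)))
        ≡⟨ sym (sumBelow-reverse a (λ i → frac 1 4 *ℚ w (suc m + i))) ⟩
      sumBelow a (λ i → frac 1 4 *ℚ w (suc m + i))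
        ≡⟨ sumBelow-*ˡ a (frac 1 4) (λ i → w (suc m + i)) ⟩
      frac 1 4 *ℚ sumBelow a (λ i → w (suc m + i))
        ≤⟨ sumBelow-w-≤ (suc m) a ⟩
      w (suc m) ∎
      where open ℚ.≤-Reasoning

    -- The two longest differences considered, d⁺ and d⁺ + 1, have co-distances m + 1 and m.
    d⁺ : ℕ
    d⁺ = suc (L₀ + (M + a))

    N≡m+d⁺ : N ≡ suc (suc m + d⁺)
    N≡m+d⁺ = trans N≡ (arith L₀ m a M)
      where
      arith : ∀ ℓ m a M → suc ℓ + (suc (suc m + a) + M) ≡ suc (suc m + suc (ℓ + (M + a)))
      arith = solve-∀

    m<d⁺ : m < L₀ + (M + a)
    m<d⁺ = ≤-trans (s≤s (m≤m+n m a)) (m≤m+n L₀ (M + a))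

    longest : Subset N → Bool
    longest S = Missing d⁺ S ∨ Missing (suc d⁺) S

    -- d⁺ and d⁺ + 1 are missing together with probability ≥ 4δ, which inclusion–exclusion subtracts.
    Pr-longest : Pr N longest ≤ℚ (frac 1 4 *ℚ w m +ℚ frac 1 4 *ℚ w m₀) - frac 4 1 *ℚ δ
    Pr-longest = begin
      Pr N longest
        ≡⟨ Pr-∨ (Missing d⁺) (Missing (suc d⁺)) ⟩
      (Pr N (Missing d⁺) +ℚ Pr N (Missing (suc d⁺))) - Pr N (λ S → Missing d⁺ S ∧ Missing (suc d⁺) S)
        ≤⟨ ℚ.+-mono-≤ (ℚ.+-mono-≤ d⁺-≤ d⁺+1-≤) (ℚ.neg-antimono-≤ (subst (_≤ℚ Pr N (λ S → Missing d⁺ S ∧ Missing (suc d⁺) S)) overlap≡4δ both-≥)) ⟩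
      (frac 1 4 *ℚ w m +ℚ frac 1 4 *ℚ w m₀) - frac 4 1 *ℚ δ ∎
      where
      open ℚ.≤-Reasoning
      d⁺-≤ : Pr N (Missing d⁺) ≤ℚ frac 1 4 *ℚ w m
      d⁺-≤ = Pr-Missing-≤-far m d⁺ N≡m+d⁺ (s≤s m<d⁺)
      d⁺+1-≤ : Pr N (Missing (suc d⁺)) ≤ℚ frac 1 4 *ℚ w m₀
      d⁺+1-≤ = Pr-Missing-≤-far m₀ (suc d⁺) (trans N≡m+d⁺ (cong suc (sym (+-suc m d⁺)))) (s≤s (≤-trans (<⇒≤ m<d⁺) (n≤1+n _)))
      both-≥ : frac 1 (2 ^ (3 + m)) {{m^n≢0 2 (3 + m)}} ≤ℚ Pr N (λ S → Missing d⁺ S ∧ Missing (suc d⁺) S)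
      both-≥ = Pr-Missing-both-≥ m d⁺ (s≤s z≤n) N≡m+d⁺ (s≤s m<d⁺)

    short middle long : Subset N → Bool
    short   S = anyBelow L₀ (λ i → Missing (suc i) S)
    middle  S = anyBelow M (λ i → Missing (suc (L₀ + i)) S)
    long    S = anyBelow a (λ i → Missing (suc (L₀ + (M + i))) S)

    missesDifferenceUpTo-split : ∀ S → missesDifferenceUpTo (N ∸ suc m) S ≡ (short S ∨ (middle S ∨ (long S ∨ longest S)))
    missesDifferenceUpTo-split S = begin
      anyBelow (N ∸ suc m) G
        ≡⟨ cong (λ k → anyBelow k G) N∸m+1≡ ⟩
      anyBelow (L₀ + (M + (a + 2))) G
        ≡⟨ anyBelow-+ L₀ (M + (a + 2)) G ⟩
      short S ∨ anyBelow (M + (a + 2)) (λ i → G (L₀ + i))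
        ≡⟨ cong (short S ∨_) (anyBelow-+ M (a + 2) (λ i → G (L₀ + i))) ⟩
      short S ∨ (middle S ∨ anyBelow (a + 2) (λ i → G (L₀ + (M + i))))
        ≡⟨ cong (λ z → short S ∨ (middle S ∨ z)) (anyBelow-+ a 2 (λ i → G (L₀ + (M + i)))) ⟩
      short S ∨ (middle S ∨ (long S ∨ (G (L₀ + (M + (a + 0))) ∨ (G (L₀ + (M + (a + 1))) ∨ false))))
        ≡⟨ cong (λ z → short S ∨ (middle S ∨ (long S ∨ z))) (cong₂ _∨_ (cong (λ x → G (L₀ + (M + x))) (+-identityʳ a))
                                                                       (trans (∨-identityʳ _) (cong G (next L₀ M a)))) ⟩
      short S ∨ (middle S ∨ (long S ∨ longest S)) ∎
      where
      open ≡-Reasoning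
      G : ℕ → Bool
      G i = Missing (suc i) S
      next : ∀ ℓ M a → ℓ + (M + (a + 1)) ≡ suc (ℓ + (M + a))
      next = solve-∀
      arith : ∀ ℓ m a M → suc ℓ + (suc (suc m + a) + M) ≡ suc m + (ℓ + (M + (a + 2)))
      arith = solve-∀
      N∸m+1≡ : N ∸ suc m ≡ L₀ + (M + (a + 2))
      N∸m+1≡ = trans (cong (_∸ suc m) (trans N≡ (arith L₀ m a M))) (m+n∸m≡n (suc m) _)

    Pr-Bad-≤ : Pr N (missesDifferenceUpTo (N ∸ suc m)) ≤ℚ w m₀ - δ
    Pr-Bad-≤ = begin
      Pr N (missesDifferenceUpTo (N ∸ suc m))
        ≡⟨ Pr-cong N missesDifferenceUpTo-split ⟩
      Pr N (λ S → short S ∨ (middle S ∨ (long S ∨ longest S)))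
        ≤⟨ ℚ.≤-trans (Pr-∨-≤ short _) (ℚ.+-monoʳ-≤ (Pr N short) (ℚ.≤-trans (Pr-∨-≤ middle _)
             (ℚ.+-monoʳ-≤ (Pr N middle) (Pr-∨-≤ long longest)))) ⟩
      Pr N short +ℚ (Pr N middle +ℚ (Pr N long +ℚ Pr N longest))
        ≤⟨ ℚ.+-mono-≤ Pr-short (ℚ.+-mono-≤ Pr-middle (ℚ.+-mono-≤ Pr-long Pr-longest)) ⟩
      δ +ℚ (δ +ℚ (w (suc m) +ℚ ((frac 1 4 *ℚ w m +ℚ frac 1 4 *ℚ w m₀) - frac 4 1 *ℚ δ)))
        ≡⟨ total (w m₀) δ ⟩
      (w m₀ - δ) - δ
        ≤⟨ ≤-−-nonneg (w m₀ - δ) δ (ℚ.<⇒≤ δ-pos) ⟩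
      w m₀ - δ ∎
      where
      open ℚ.≤-Reasoning
      -- (3/4)² + (1/4)(3/4) + 1/4 = 1
      total : ∀ W δ → δ +ℚ (δ +ℚ (frac 3 4 *ℚ (frac 3 4 *ℚ W) +ℚ ((frac 1 4 *ℚ (frac 3 4 *ℚ W) +ℚ frac 1 4 *ℚ W) - frac 4 1 *ℚ δ)))
                      ≡ (W - δ) - δ
      total = solve 2 (λ W δ → δ :+ (δ :+ (con (frac 3 4) :* (con (frac 3 4) :* W) :+
                               ((con (frac 1 4) :* (con (frac 3 4) :* W) :+ con (frac 1 4) :* W) :- con (frac 4 1) :* δ)))
                             := (W :- δ) :- δ) refl

does-≟-cong : {a b c d : ℕ} → (a ≡ b → c ≡ d) → (c ≡ d → a ≡ b) → does (a ≟ b) ≡ does (c ≟ d)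
does-≟-cong {a} {b} {c} {d} to from =
  Bool-ext (λ h → dec-true (c ≟ d) (to (witness (a ≟ b) h))) (λ h → dec-true (a ≟ b) (from (witness (c ≟ d) h)))
  where
  witness : {P : Set} (p? : Dec P) → does p? ≡ true → P
  witness (yes p) _ = p

Q≈upperProbability : (h K n : ℕ) → BadBound.N₀ h ≤ n → ∣ Q n K - upperProbability (suc h) K ∣ ≤ℚ w h - BadBound.δ h
Q≈upperProbability h K n N₀≤n =
  subst (λ n → N₀ ≤ n → ∣ Q n K - upperProbability H K ∣ ≤ℚ w h - δ) (sym n≡)
        (λ N₀≤N → ℚ.≤-trans (Pr-deficiency-≈ K) (BadBound.AtLength.Pr-Bad-≤ h N N₀≤N)) N₀≤n
  where
  open BadBound h using (N₀; δ; L; a; L+L≤N₀)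
  r : ℕ
  r = n ∸ (suc h + suc h)
  open Layout h r
  H≤L : H ≤ L
  H≤L = ≤-trans (n≤1+n H) (≤-trans (m≤m+n (suc H) a) (n≤1+n _))
  H+H≤n : H + H ≤ n
  H+H≤n = ≤-trans (+-mono-≤ H≤L H≤L) (≤-trans L+L≤N₀ N₀≤n)
  arith : ∀ H r → (H + H) + r ≡ H + (r + (H + 0))
  arith = solve-∀
  n≡ : n ≡ N
  n≡ = trans (sym (m+[n∸m]≡n H+H≤n)) (arith H r)

upperDeficiency-double : (m k : ℕ) → k < m → (T : Subset (2 * m)) →
                         does (upperDeficiency m T + upperDeficiency m T ≟ 2 * k) ≡ does (diffUpperSize m T ≟ m ∸ k)
upperDeficiency-double m k k<m T = does-≟-cong to from
  where
  U : ℕ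
  U = diffUpperSize m T
  to : (m ∸ U) + (m ∸ U) ≡ 2 * k → U ≡ m ∸ k
  to e = trans (sym (m∸[m∸n]≡n (diffUpperSize-≤ m T))) (cong (m ∸_) (*-cancelˡ-≡ (m ∸ U) k 2 (trans (cong ((m ∸ U) +_) (+-identityʳ _)) e)))
  from : U ≡ m ∸ k → (m ∸ U) + (m ∸ U) ≡ 2 * k
  from e = trans (cong (λ x → x + x) (trans (cong (m ∸_) e) (m∸[m∸n]≡n (<⇒≤ k<m)))) (cong (k +_) (sym (+-identityʳ k)))

Q-Cauchy : (k : ℕ) (ε : ℚ) → 0ℚ <ℚ ε → ∃[ N ] ((n n′ : ℕ) → N ≤ n → N ≤ n′ → ∣ Q n k - Q n′ k ∣ <ℚ ε)
Q-Cauchy k ε ε>0 with positive⇒1/[1+d]≤ ε ε>0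
... | d , 1/[d+1]≤ε = N₀ , λ n n′ N₀≤n N₀≤n′ → begin-strict
  ∣ Q n k - Q n′ k ∣   ≤⟨ ∣-∣-≤-triangle (Q n k) (Q n′ k) (upperProbability (suc t) k) (w t) (close n N₀≤n) (close n′ N₀≤n′) ⟩
  w t +ℚ w t           <⟨ 2w<1/[d+1] ⟩
  frac 1 (suc d)       ≤⟨ 1/[d+1]≤ε ⟩
  ε                    ∎
  where
  open ℚ.≤-Reasoning
  s t : ℕ
  s = 2 * suc d
  t = 5 * s
  open BadBound t using (N₀; δ; δ-pos)
  close : ∀ n → N₀ ≤ n → ∣ Q n k - upperProbability (suc t) k ∣ ≤ℚ w t
  close n N₀≤n = ℚ.≤-trans (Q≈upperProbability t k n N₀≤n) (≤-−-nonneg (w t) δ (ℚ.<⇒≤ δ-pos))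
  2w<1/[d+1] : w t +ℚ w t <ℚ frac 1 (suc d)
  2w<1/[d+1] = begin-strict
    w t +ℚ w t                                       ≤⟨ ℚ.+-mono-≤ (w-5t-≤ s) (w-5t-≤ s) ⟩
    frac 1 (4 ^ s) {{nz}} +ℚ frac 1 (4 ^ s) {{nz}}    ≡⟨ frac-+-same 1 1 (4 ^ s) {{nz}} ⟩
    frac 2 (4 ^ s) {{nz}}                            <⟨ frac-< 2 (4 ^ s) 1 (suc d) {{nz}} (≤-trans (n<2^n s) (≤-trans (2^≤4^ s) (≤-reflexive (sym (*-identityˡ _))))) ⟩
    frac 1 (suc d)                                   ∎
    where
    nz : NonZero (4 ^ s)
    nz = m^n≢0 4 s

Q≈g : (k m : ℕ) → k < m →
        ∃[ δ ] (0ℚ <ℚ δ × ∃[ N ] ((n : ℕ) → N ≤ n → ∣ Q n (2 * k) - g k m ∣ ≤ℚ bound m - δ))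
Q≈g k (suc m₀) k<m = δ , δ-pos , N₀ , λ n N₀≤n →
  subst₂ (λ x y → ∣ Q n (2 * k) - x ∣ ≤ℚ y - δ) Pr≡g (sym bound≡w) (Q≈upperProbability m₀ (2 * k) n N₀≤n)
  where
  open BadBound m₀ using (N₀; δ; δ-pos; m)
  Pr≡g : upperProbability m (2 * k) ≡ g k m
  Pr≡g = Pr-cong (2 * m) (upperDeficiency-double m k k<m)
  bound≡w : bound m ≡ w m₀
  bound≡w = solve 1 (λ W → con (frac 16 9) :* (con (frac 3 4) :* (con (frac 3 4) :* W)) := W) refl (w m₀)

proposition3p13 : ((k : ℕ) → (ε : ℚ) → 0ℚ <ℚ ε →
    ∃[ N ] ((n n′ : ℕ) → N ≤ n → N ≤ n′ → ∣ Q n k - Q n′ k ∣ <ℚ ε))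
    × ((k m : ℕ) → k < m →
    ∃[ δ ] (0ℚ <ℚ δ × ∃[ N ] ((n : ℕ) → N ≤ n → ∣ Q n (2 * k) - g k m ∣ ≤ℚ bound m - δ)))
proposition3p13 = Q-Cauchy , Q≈g
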